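{- For all finite sets $X_1,X_2$ and topologies $\mathcal T_1$ on $X_1$, $\mathcal T_2$ on $X_2$, one has $\Gamma(\mathcal T_1\mathcal T_2)=\Gamma(\mathcal T_1)\Gamma(\mathcal T_2)$, i.e. $\Gamma\circ m=(m\otimes m)\circ\tau^{2,3}\circ(\Gamma\otimes\Gamma)$ as maps $\mathbb T_{X_1}\otimes\mathbb T_{X_2}\to\mathbb T_{X_1\sqcup X_2}\otimes\mathbb T_{X_1\sqcup X_2}$, where $\tau^{2,3}$ exchanges the second and third tensor factors.
   Context: For a finite set $X$, $\mathbb T_X$ is the vector space freely generated by topologies on $X$. The product $m:\mathbb T_{X_1}\otimes\mathbb T_{X_2}\to\mathbb T_{X_1\sqcup X_2}$, $\mathcal T_1\otimes\mathcal T_2\mapsto\mathcal T_1\mathcal T_2$, where $Y\in\mathcal T_1\mathcal T_2$ iff $Y\cap X_1\in\mathcal T_1$ and $Y\cap X_2\in\mathcal T_2$. For a topology $\mathcal T$, $x\le_{\mathcal T}y$ iff every open set containing $x$ contains $y$ (open sets = final segments of this quasi-order); $x\sim_{\mathcal T}y$ iff $x\le_{\mathcal T}y\le_{\mathcal T}x$. $\mathcal T'\prec\mathcal T$ means every $\mathcal T$-open set is $\mathcal T'$-open. For $\mathcal T'\prec\mathcal T$, $\mathcal T/\mathcal T'$ is the topology on the same set with quasi-order the transitive closure of $x\,\mathcal R\,y\iff(x\le_{\mathcal T}y\text{ or }y\le_{\mathcal T'}x)$. $\mathcal T|_Y=\{Z\cap Y:Z\in\mathcal T\}$; $Y$ is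 $\mathcal T$-connected if $(Y,\mathcal T|_Y)$ is connected. $\mathcal T'$ is $\mathcal T$-admissible if $\mathcal T'\prec\mathcal T$, $\mathcal T'|_Y=\mathcal T|_Y$ for all $\mathcal T'$-connected $Y$, and $x\sim_{\mathcal T/\mathcal T'}y\iff x\sim_{\mathcal T'/\mathcal T'}y$. $\Gamma(\mathcal T)=\sum_{\mathcal T'\ \mathcal T\text{ -admissible}}\mathcal T'\otimes\mathcal T/\mathcal T'$, extended linearly; products in $\mathbb T\otimes\mathbb T$ are taken componentwise. -}

module Defs where

-- Finite topologies, encoded computably (everything is decidable on finite sets).
-- A finite set X with n elements is Fin n; X₁ ⊔ X₂ is Fin (n₁ + n₂)
-- (first n₁ points = X₁, last n₂ points = X₂).

open import Data.Bool using (Bool; true; false; _∧_; _∨_; not)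
open import Data.Nat using (ℕ; zero; suc; _+_)
open import Data.Fin using (Fin)
open import Data.Fin.Subset using (Subset; _∩_; _∪_; ⊥; ⊤)
open import Data.Vec using (Vec; []; _∷_; lookup; take; drop)
open import Data.List using (List; []; _∷_; map; _++_; filterᵇ; allFin; concatMap; length)
open import Data.Bool.ListAction using (all; any)
open import Data.Product using (_×_; _,_; proj₁; proj₂)

_⇔ᵇ_ : Bool → Bool → Bool
a ⇔ᵇ b = (a ∧ b) ∨ (not a ∧ not b)

allSubsets : ∀ n → List (Subset n)
allSubsets zero    = [] ∷ []
allSubsets (suc n) = map (true ∷_) (allSubsets n) ++ map (false ∷_) (allSubsets n)

sublists : ∀ {A : Set} → List A → List (List A)
sublists []       = [] ∷ []
sublists (x ∷ xs) = map (x ∷_) (sublists xs) ++ sublists xs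

eqSub : ∀ {n} → Subset n → Subset n → Bool
eqSub []       []       = true
eqSub (a ∷ as) (b ∷ bs) = (a ⇔ᵇ b) ∧ eqSub as bs

isEmpty : ∀ {n} → Subset n → Bool
isEmpty []       = true
isEmpty (a ∷ as) = not a ∧ isEmpty as

Family : ℕ → Set
Family n = List (Subset n)

memᵇ : ∀ {n} → Subset n → Family n → Bool
memᵇ Y F = any (eqSub Y) F

famEq : ∀ {n} → Family n → Family n → Bool
famEq {n} F G = all (λ Y → memᵇ Y F ⇔ᵇ memᵇ Y G) (allSubsets n)

-- F is a topology on Fin n (finite set: binary unions/intersections suffice)
isTopology : ∀ {n} → Family n → Bool
isTopology F = memᵇ ⊥ F ∧ memᵇ ⊤ F
  ∧ all (λ U → all (λ V → memᵇ (U ∩ V) F ∧ memᵇ (U ∪ V) F) F) F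

topologies : ∀ n → List (Family n)
topologies n = filterᵇ isTopology (sublists (allSubsets n))

leq : ∀ {n} → Family n → Fin n → Fin n → Bool
leq F x y = all (λ U → not (lookup U x) ∨ lookup U y) F

sim : ∀ {n} → Family n → Fin n → Fin n → Bool
sim F x y = leq F x y ∧ leq F y x

finer : ∀ {n} → Family n → Family n → Bool
finer T' T = all (λ U → memᵇ U T') T

-- T / T' : the topology whose quasi-order is the transitive closure of
-- x R y ⇔ (x ≤_T y or y ≤_T' x); its open sets are the final segments of
-- that quasi-order, i.e. the subsets closed upward under R.
quotient : ∀ {n} → Family n → Family n → Family n
quotient {n} T T' = filterᵇ upClosed (allSubsets n)
  where
  R : Fin n → Fin n → Bool
  R x y = leq T x y ∨ leq T' y x
  upClosed : Subset n → Bool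
  upClosed Y = all (λ x → all (λ y → not (R x y ∧ lookup Y x) ∨ lookup Y y) (allFin n)) (allFin n)

restrict : ∀ {n} → Family n → Subset n → Family n
restrict F Y = map (λ Z → Z ∩ Y) F

connected : ∀ {n} → Family n → Subset n → Bool
connected F Y = all (λ U → all (λ V →
    not (isEmpty (U ∩ V) ∧ eqSub (U ∪ V) Y) ∨ isEmpty U ∨ isEmpty V)
  (restrict F Y)) (restrict F Y)

admissible : ∀ {n} → Family n → Family n → Bool
admissible {n} T T' = finer T' T
  ∧ all (λ Y → not (connected T' Y) ∨ famEq (restrict T' Y) (restrict T Y)) (allSubsets n)
  ∧ all (λ x → all (λ y → sim (quotient T T') x y ⇔ᵇ sim (quotient T' T') x y) (allFin n)) (allFin n)

-- Elements of 𝕋_X ⊗ 𝕋_X with ℕ coefficients, as formal sums (lists of basis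
-- tensors T ⊗ T'); the coefficient of A ⊗ B is counted below.
Tensor2 : ℕ → Set
Tensor2 n = List (Family n × Family n)

Γ : ∀ {n} → Family n → Tensor2 n
Γ {n} T = map (λ T' → T' , quotient T T') (filterᵇ (admissible T) (topologies n))

prod : ∀ {n₁ n₂} → Family n₁ → Family n₂ → Family (n₁ + n₂)
prod {n₁} {n₂} T₁ T₂ =
  filterᵇ (λ Y → memᵇ (take n₁ Y) T₁ ∧ memᵇ (drop n₁ Y) T₂) (allSubsets (n₁ + n₂))

-- componentwise product in 𝕋⊗𝕋, extended bilinearly:
-- (m ⊗ m) ∘ τ^{2,3} on formal sums
prodT : ∀ {n₁ n₂} → Tensor2 n₁ → Tensor2 n₂ → Tensor2 (n₁ + n₂)
prodT L M = concatMap (λ p → map (λ q → prod (proj₁ p) (proj₁ q) , prod (proj₂ p) (proj₂ q)) M) L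

coeff : ∀ {n} → Family n → Family n → Tensor2 n → ℕ
coeff A B L = length (filterᵇ (λ p → famEq (proj₁ p) A ∧ famEq (proj₂ p) B) L)

-- A topology T' finer than T₁T₂ has X₁ and X₂ among its open sets, so it is the product A₁A₂ of
-- its traces on X₁ and X₂. For such products every clause of admissibility splits factorwise: the
-- specialisation order of a product is the disjoint union of the orders of the factors, hence
-- (T₁T₂)/(A₁A₂) = (T₁/A₁)(T₂/A₂) and no ∼-class meets both factors; and a connected set lies in X₁
-- or in X₂, its traces on X₁ and X₂ being complementary open subsets of it. So A ⊗ B occurs in
-- Γ(T₁T₂) iff A = A₁A₂, B = B₁B₂ and Aᵢ ⊗ Bᵢ occurs in Γ(Tᵢ). As Γ lists each admissible topology
-- once, all coefficients are 0 or 1, and the identity is the product rule for these indicators.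

module Submission where

open import Defs
open import Data.Nat using (ℕ; _+_)
open import Data.Bool using (T)
open import Relation.Binary.PropositionalEquality using (_≡_)

open import Data.Bool using (Bool; true; false; _∧_; _∨_; not; T?; if_then_else_)
open import Data.Bool.ListAction using (all)
open import Data.Bool.Properties using (T-≡; T-∧; T-∨; ∧-identityʳ; ∧-zeroʳ; ∧-commutativeMonoid)
open import Algebra.Solver.CommutativeMonoid ∧-commutativeMonoid using (solve; _⊜_; _⊕_)
open import Data.Empty using (⊥-elim)
open import Data.Fin as Fin using (Fin; _↑ˡ_; _↑ʳ_)
open import Data.Fin.Properties using (splitAt⁻¹-↑ˡ; splitAt⁻¹-↑ʳ)
open import Data.Fin.Subset using (Subset; _∩_; _∪_; ⊥; ⊤)
open import Data.Fin.Subset.Properties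
  using (∩-identityˡ; ∩-identityʳ; ∩-zeroˡ; ∩-zeroʳ; ∪-identityˡ; ∪-identityʳ)
open import Data.List using (List; []; _∷_; _++_; map; filterᵇ; allFin; length; concatMap)
open import Data.List.Properties using (filter-++; length-++)
open import Data.List.Membership.Propositional using (_∈_; _∉_)
open import Data.List.Membership.Propositional.Properties
  using (∈-map⁺; ∈-map⁻; ∈-++⁺ˡ; ∈-++⁺ʳ; ∈-++⁻; ∈-filter⁺; ∈-filter⁻; ∈-allFin)
open import Data.List.Relation.Binary.Disjoint.Propositional using (Disjoint)
open import Data.List.Relation.Binary.Subset.Propositional using (_⊆_)
open import Data.List.Relation.Binary.Subset.Propositional.Properties using (map⁺)
import Data.List.Relation.Unary.All as All
open import Data.List.Relation.Unary.All.Properties using (all⁺; all⁻)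
open import Data.List.Relation.Unary.AllPairs using ([]; _∷_)
open import Data.List.Relation.Unary.Any as Any using (Any)
open import Data.List.Relation.Unary.Any.Properties using (any⁺; any⁻)
open import Data.List.Relation.Unary.Unique.Propositional using (Unique)
import Data.List.Relation.Unary.Unique.Propositional.Properties as Unique
open import Data.Nat using (zero; suc; _*_)
open import Data.Nat.Properties using (+-identityʳ; *-identityʳ; *-distribʳ-+)
open import Data.Product using (∃-syntax; _×_; _,_; proj₁; proj₂)
open import Data.Product.Function.NonDependent.Propositional using (_×-⇔_)
open import Data.Sum as Sum using (_⊎_; inj₁; inj₂)
open import Data.Vec as Vec using (Vec; _∷_; []; lookup; take; drop; replicate) renaming (_++_ to _++ᵛ_)
open import Data.Vec.Properties
  using ( lookup-replicate; lookup-++ˡ; lookup-++ʳ; ++-injective; ++-injectiveˡ; ++-injectiveʳ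
        ; take++drop≡id; zipWith-++; ∷-injectiveʳ )
open import Function using (_∘_; const; id)
open import Function.Bundles using (_⇔_; mk⇔; Equivalence)
open import Function.Construct.Composition using (_⇔-∘_)
open import Relation.Binary.PropositionalEquality
  using (_≢_; refl; sym; trans; cong; cong₂; subst; module ≡-Reasoning)
open import Relation.Nullary using (¬_)

open Equivalence using (to; from)

private variable
  n : ℕ
  a b : Bool
  A B C : Set

T-injective : (T a → T b) → (T b → T a) → a ≡ b
T-injective {false} {false} _ _ = refl
T-injective {false} {true}  _ g = ⊥-elim (g _)
T-injective {true}  {false} f _ = ⊥-elim (f _)
T-injective {true}  {true}  _ _ = refl

¬T⇒≡false : ¬ T a → a ≡ false
¬T⇒≡false ¬a = T-injective (⊥-elim ∘ ¬a) (λ ())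

infixr 2 _∧-⇔_
_∧-⇔_ : {P Q : Set} → T a ⇔ P → T b ⇔ Q → T (a ∧ b) ⇔ (P × Q)
a⇔P ∧-⇔ b⇔Q = (a⇔P ×-⇔ b⇔Q) ⇔-∘ T-∧

≡-by-reflection : {P Q : Set} → T a ⇔ P → T b ⇔ Q → (P → Q) → (Q → P) → a ≡ b
≡-by-reflection a⇔P b⇔Q P⇒Q Q⇒P =
  T-injective (from b⇔Q ∘ P⇒Q ∘ to a⇔P) (from a⇔P ∘ Q⇒P ∘ to b⇔Q)

T-⇔ᵇ : T (a ⇔ᵇ b) ⇔ (a ≡ b)
T-⇔ᵇ {false} {false} = mk⇔ (const refl) (const _)
T-⇔ᵇ {false} {true}  = mk⇔ (λ ()) (λ ())
T-⇔ᵇ {true}  {false} = mk⇔ (λ ()) (λ ())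
T-⇔ᵇ {true}  {true}  = mk⇔ (const refl) (const _)

true-⇔ᵇ : ∀ b → (true ⇔ᵇ b) ≡ b
true-⇔ᵇ false = refl
true-⇔ᵇ true  = refl

false-⇔ᵇ : ∀ b → (false ⇔ᵇ b) ≡ not b
false-⇔ᵇ false = refl
false-⇔ᵇ true  = refl

T-implies : T (not a ∨ b) ⇔ (T a → T b)
T-implies {false}         = mk⇔ (λ _ ()) (const _)
T-implies {true}  {false} = mk⇔ (λ ()) (λ f → f _)
T-implies {true}  {true}  = mk⇔ (const id) (const _)

T-all : (p : A → Bool) (xs : List A) → T (all p xs) ⇔ (∀ {x} → x ∈ xs → T (p x))
T-all p xs = mk⇔ (All.lookup ∘ all⁺ p xs) (all⁻ p ∘ All.tabulate)

T-all² : (p : A → A → Bool) (xs : List A) →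
  T (all (λ x → all (p x) xs) xs) ⇔ (∀ {x y} → x ∈ xs → y ∈ xs → T (p x y))
T-all² p xs = mk⇔
  (λ h {x} {y} x∈xs → to (T-all (p x) xs) (to (T-all _ xs) h x∈xs))
  (λ h → from (T-all _ xs) λ {x} x∈xs → from (T-all (p x) xs) (h x∈xs))

all-cong : {p q : A → Bool} (xs : List A) → (∀ {x} → x ∈ xs → p x ≡ q x) → all p xs ≡ all q xs
all-cong []       _   = refl
all-cong (x ∷ xs) p≡q = cong₂ _∧_ (p≡q (Any.here refl)) (all-cong xs (p≡q ∘ Any.there))

∈-filterᵇ : (p : A → Bool) {xs : List A} {x : A} → x ∈ filterᵇ p xs ⇔ (x ∈ xs × T (p x))
∈-filterᵇ p = mk⇔ (∈-filter⁻ (T? ∘ p)) (λ (x∈xs , px) → ∈-filter⁺ (T? ∘ p) x∈xs px)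

T-eqSub : {Y Z : Subset n} → T (eqSub Y Z) ⇔ Y ≡ Z
T-eqSub {Y = []}    {[]}    = mk⇔ (const refl) (const _)
T-eqSub {Y = a ∷ Y} {b ∷ Z} = mk⇔
  (λ h → let a≡b , Y≡Z = to (T-∧ {a ⇔ᵇ b}) h in cong₂ _∷_ (to T-⇔ᵇ a≡b) (to T-eqSub Y≡Z))
  (λ { refl → from (T-∧ {a ⇔ᵇ a}) (from (T-⇔ᵇ {a}) refl , from (T-eqSub {Y = Y}) refl) })

T-isEmpty : ∀ {n} {Y : Subset n} → T (isEmpty Y) ⇔ Y ≡ ⊥
T-isEmpty {Y = []}            = mk⇔ (const refl) (const _)
T-isEmpty {suc n} {false ∷ Y} =
  mk⇔ (cong (false ∷_) ∘ to T-isEmpty) (λ { refl → from (T-isEmpty {n} {⊥}) refl })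
T-isEmpty {Y = true ∷ Y}      = mk⇔ (λ ()) (λ ())

∈-allSubsets : (Y : Subset n) → Y ∈ allSubsets n
∈-allSubsets []          = Any.here refl
∈-allSubsets (true ∷ Y)  = ∈-++⁺ˡ (∈-map⁺ (true ∷_) (∈-allSubsets Y))
∈-allSubsets (false ∷ Y) = ∈-++⁺ʳ _ (∈-map⁺ (false ∷_) (∈-allSubsets Y))

∈-filterᵇ-allSubsets : (p : Subset n → Bool) {Y : Subset n} → Y ∈ filterᵇ p (allSubsets n) ⇔ T (p Y)
∈-filterᵇ-allSubsets {n} p {Y} = mk⇔
  (proj₂ ∘ to (∈-filterᵇ p {allSubsets n})) (λ pY → from (∈-filterᵇ p {allSubsets n}) (∈-allSubsets Y , pY))

T-memᵇ : {Y : Subset n} {F : Family n} → T (memᵇ Y F) ⇔ Y ∈ F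
T-memᵇ {Y = Y} {F} = mk⇔
  (Any.map (to T-eqSub) ∘ any⁻ (eqSub Y) F)
  (any⁺ (eqSub Y) ∘ Any.map (from T-eqSub))

memᵇ-here : (Y : Subset n) (F : Family n) → memᵇ Y (Y ∷ F) ≡ true
memᵇ-here Y F = to T-≡ (from (T-memᵇ {Y = Y} {Y ∷ F}) (Any.here refl))

memᵇ-there : {Y Z : Subset n} {F : Family n} → Y ≢ Z → memᵇ Y (Z ∷ F) ≡ memᵇ Y F
memᵇ-there {Y = Y} {Z} {F} Y≢Z = ≡-by-reflection (T-memᵇ {Y = Y} {Z ∷ F}) T-memᵇ
  (λ { (Any.here Y≡Z) → ⊥-elim (Y≢Z Y≡Z) ; (Any.there Y∈F) → Y∈F }) Any.there

_≈_ : Family n → Family n → Set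
F ≈ G = F ⊆ G × G ⊆ F

≈-refl : {F : Family n} → F ≈ F
≈-refl = id , id

≈-sym : {F G : Family n} → F ≈ G → G ≈ F
≈-sym (F⊆G , G⊆F) = G⊆F , F⊆G

≈-trans : {F G H : Family n} → F ≈ G → G ≈ H → F ≈ H
≈-trans (F⊆G , G⊆F) (G⊆H , H⊆G) = G⊆H ∘ F⊆G , G⊆F ∘ H⊆G

memᵇ-resp-≈ : {F G : Family n} → F ≈ G → (Y : Subset n) → memᵇ Y F ≡ memᵇ Y G
memᵇ-resp-≈ (F⊆G , G⊆F) Y = ≡-by-reflection T-memᵇ T-memᵇ (F⊆G {Y}) (G⊆F {Y})

T-famEq : {F G : Family n} → T (famEq F G) ⇔ F ≈ G
T-famEq {n} {F} {G} = mk⇔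
  (λ h → let memF≡memG = λ Y → to T-⇔ᵇ (to (T-all _ (allSubsets n)) h (∈-allSubsets Y))
         in (λ {Y} → transport (memF≡memG Y)) , (λ {Y} → transport (sym (memF≡memG Y))))
  (λ F≈G → from (T-all _ (allSubsets n)) (λ {Y} _ → from T-⇔ᵇ (memᵇ-resp-≈ F≈G Y)))
  where
  transport : {Y : Subset n} {H H' : Family n} → memᵇ Y H ≡ memᵇ Y H' → Y ∈ H → Y ∈ H'
  transport eq = to T-memᵇ ∘ subst T eq ∘ from T-memᵇ

famEq-resp-≈ : {F F' G G' : Family n} → F ≈ F' → G ≈ G' → famEq F G ≡ famEq F' G'
famEq-resp-≈ F≈F' G≈G' = ≡-by-reflection T-famEq T-famEq
  (λ F≈G → ≈-trans (≈-sym F≈F') (≈-trans F≈G G≈G'))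
  (λ F'≈G' → ≈-trans F≈F' (≈-trans F'≈G' (≈-sym G≈G')))

map-resp-≈ : ∀ {m} (f : Subset n → Subset m) {R R' : Family n} → R ≈ R' → map f R ≈ map f R'
map-resp-≈ f (R⊆R' , R'⊆R) = map⁺ f R⊆R' , map⁺ f R'⊆R

map-reflects-≈ : ∀ {m} {f : Subset n → Subset m} → (∀ {U V} → f U ≡ f V → U ≡ V) →
  {R R' : Family n} → map f R ≈ map f R' → R ≈ R'
map-reflects-≈ {f = f} f-inj (fR⊆fR' , fR'⊆fR) = reflect fR⊆fR' , reflect fR'⊆fR
  where
  reflect : ∀ {R R'} → map f R ⊆ map f R' → R ⊆ R'
  reflect {R' = R'} fR⊆fR' U∈ with ∈-map⁻ f (fR⊆fR' (∈-map⁺ f U∈))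
  ... | V , V∈ , fU≡fV = subst (_∈ R') (sym (f-inj fU≡fV)) V∈

-- Topologies, the specialisation order and quotients

record Pointed (F : Family n) : Set where
  field
    ⊥∈ : ⊥ ∈ F
    ⊤∈ : ⊤ ∈ F

record IsTopology (F : Family n) : Set where
  field
    pointed  : Pointed F
    ∩-closed : ∀ {U V} → U ∈ F → V ∈ F → U ∩ V ∈ F
    ∪-closed : ∀ {U V} → U ∈ F → V ∈ F → U ∪ V ∈ F
  open Pointed pointed public

T-isTopology : {F : Family n} → T (isTopology F) ⇔ IsTopology F
T-isTopology {n} {F} = mk⇔
  (λ h → let ⊥∈ , ⊤∈ , closed = to axioms h in record
    { pointed  = record { ⊥∈ = ⊥∈ ; ⊤∈ = ⊤∈ }
    ; ∩-closed = λ {U} {V} U∈F V∈F → proj₁ (to (closedᵇ U V) (closed U∈F V∈F))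
    ; ∪-closed = λ {U} {V} U∈F V∈F → proj₂ (to (closedᵇ U V) (closed U∈F V∈F)) })
  (λ top → let open IsTopology top in from axioms
    (⊥∈ , ⊤∈ , λ {U} {V} U∈F V∈F → from (closedᵇ U V) (∩-closed U∈F V∈F , ∪-closed U∈F V∈F)))
  where
  closedᵇ : ∀ U V → T (memᵇ (U ∩ V) F ∧ memᵇ (U ∪ V) F) ⇔ (U ∩ V ∈ F × U ∪ V ∈ F)
  closedᵇ U V = T-memᵇ ∧-⇔ T-memᵇ
  axioms = T-memᵇ ∧-⇔ T-memᵇ ∧-⇔ T-all² (λ U V → memᵇ (U ∩ V) F ∧ memᵇ (U ∪ V) F) F

IsTopology-resp-≈ : {F G : Family n} → F ≈ G → IsTopology F → IsTopology G
IsTopology-resp-≈ (F⊆G , G⊆F) top = record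
  { pointed  = record { ⊥∈ = F⊆G ⊥∈ ; ⊤∈ = F⊆G ⊤∈ }
  ; ∩-closed = λ U∈G V∈G → F⊆G (∩-closed (G⊆F U∈G) (G⊆F V∈G))
  ; ∪-closed = λ U∈G V∈G → F⊆G (∪-closed (G⊆F U∈G) (G⊆F V∈G)) }
  where open IsTopology top

isTopology-resp-≈ : {F G : Family n} → F ≈ G → isTopology F ≡ isTopology G
isTopology-resp-≈ F≈G = ≡-by-reflection T-isTopology T-isTopology
  (IsTopology-resp-≈ F≈G) (IsTopology-resp-≈ (≈-sym F≈G))

_≤[_]_ : Fin n → Family n → Fin n → Set
x ≤[ F ] y = ∀ {U} → U ∈ F → T (lookup U x) → T (lookup U y)

T-leq : {F : Family n} {x y : Fin n} → T (leq F x y) ⇔ x ≤[ F ] y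
T-leq {F = F} {x} {y} = mk⇔
  (λ h {U} U∈F → to (T-implies {lookup U x}) (to (T-all _ F) h U∈F))
  (λ x≤y → from (T-all _ F) λ U∈F → from T-implies (x≤y U∈F))

≤-resp-≈ : {F G : Family n} {x y : Fin n} → F ≈ G → x ≤[ F ] y → x ≤[ G ] y
≤-resp-≈ (_ , G⊆F) x≤y U∈G = x≤y (G⊆F U∈G)

leq-resp-≈ : {F G : Family n} → F ≈ G → (x y : Fin n) → leq F x y ≡ leq G x y
leq-resp-≈ F≈G x y = ≡-by-reflection T-leq T-leq (≤-resp-≈ F≈G) (≤-resp-≈ (≈-sym F≈G))

sim-resp-≈ : {F G : Family n} → F ≈ G → (x y : Fin n) → sim F x y ≡ sim G x y
sim-resp-≈ F≈G x y = cong₂ _∧_ (leq-resp-≈ F≈G x y) (leq-resp-≈ F≈G y x)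

UpClosed : Family n → Family n → Subset n → Set
UpClosed F F' Y = ∀ {x y} → x ≤[ F ] y ⊎ y ≤[ F' ] x → T (lookup Y x) → T (lookup Y y)

∈-quotient : {F F' : Family n} {Y : Subset n} → Y ∈ quotient F F' ⇔ UpClosed F F' Y
∈-quotient {n} {F} {F'} {Y} = mk⇔
  (λ Y∈ {x} {y} x→y Yx → to (T-implies {step x y ∧ lookup Y x})
     (to (T-all² _ (allFin n)) (to (∈-filterᵇ-allSubsets _) Y∈) (∈-allFin x) (∈-allFin y))
     (from T-∧ (from T-∨ (Sum.map (from T-leq) (from T-leq) x→y) , Yx)))
  (λ up → from (∈-filterᵇ-allSubsets _) (from (T-all² _ (allFin n)) λ {x} {y} _ _ →
     from T-implies λ h → let x→y , Yx = to (T-∧ {step x y}) h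
                          in up (Sum.map (to T-leq) (to T-leq) (to T-∨ x→y)) Yx))
  where
  step : Fin n → Fin n → Bool
  step x y = leq F x y ∨ leq F' y x

quotient-resp-≈ : {F F' G G' : Family n} → F ≈ G → F' ≈ G' → quotient F F' ≈ quotient G G'
quotient-resp-≈ F≈G F'≈G' = resp F≈G F'≈G' , resp (≈-sym F≈G) (≈-sym F'≈G')
  where
  resp : ∀ {F F' G G'} → F ≈ G → F' ≈ G' → quotient F F' ⊆ quotient G G'
  resp F≈G F'≈G' Y∈ = from ∈-quotient λ x→y →
    to ∈-quotient Y∈ (Sum.map (≤-resp-≈ (≈-sym F≈G)) (≤-resp-≈ (≈-sym F'≈G')) x→y)

quotient-pointed : (F F' : Family n) → Pointed (quotient F F')
quotient-pointed F F' = record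
  { ⊥∈ = from (∈-quotient {F = F} {F'}) λ {x} _ ⊥x → ⊥-elim (subst T (lookup-replicate x false) ⊥x)
  ; ⊤∈ = from (∈-quotient {F = F} {F'}) λ {_} {y} _ _ → subst T (sym (lookup-replicate y true)) _ }

-- Connectedness and admissibility

IsConnected : Family n → Subset n → Set
IsConnected R Y = ∀ {U V} → U ∈ R → V ∈ R → U ∩ V ≡ ⊥ → U ∪ V ≡ Y → U ≡ ⊥ ⊎ V ≡ ⊥

IsConnected-resp-≈ : {R R' : Family n} {Y : Subset n} → R ≈ R' → IsConnected R Y → IsConnected R' Y
IsConnected-resp-≈ (_ , R'⊆R) con U∈R' V∈R' = con (R'⊆R U∈R') (R'⊆R V∈R')

T-connected : {F : Family n} {Y : Subset n} → T (connected F Y) ⇔ IsConnected (restrict F Y) Y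
T-connected {F = F} {Y} = mk⇔
  (λ h {U} {V} U∈R V∈R U∩V≡⊥ U∪V≡Y →
     Sum.map (to T-isEmpty) (to T-isEmpty) (to (T-∨ {isEmpty U})
       (to (T-implies {isEmpty (U ∩ V) ∧ eqSub (U ∪ V) Y}) (to (T-all² _ R) h U∈R V∈R)
         (from T-∧ (from T-isEmpty U∩V≡⊥ , from T-eqSub U∪V≡Y)))))
  (λ con → from (T-all² _ R) λ {U} {V} U∈R V∈R → from T-implies λ h →
     let U∩V≡⊥ , U∪V≡Y = to (T-∧ {isEmpty (U ∩ V)}) h
     in from T-∨ (Sum.map (from T-isEmpty) (from T-isEmpty)
          (con U∈R V∈R (to T-isEmpty U∩V≡⊥) (to T-eqSub U∪V≡Y))))
  where
  R = restrict F Y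

IsConnected-embedding : ∀ {m} {f : Subset n → Subset m} → (∀ {U V} → f U ≡ f V → U ≡ V) → f ⊥ ≡ ⊥ →
  (∀ U V → f (U ∩ V) ≡ f U ∩ f V) → (∀ U V → f (U ∪ V) ≡ f U ∪ f V) →
  ∀ {R Y} → IsConnected (map f R) (f Y) ⇔ IsConnected R Y
IsConnected-embedding {f = f} f-inj f⊥ f∩ f∪ {R} {Y} = mk⇔ reflect preserve
  where
  reflect : IsConnected (map f R) (f Y) → IsConnected R Y
  reflect con {U} {V} U∈ V∈ U∩V≡⊥ U∪V≡Y =
    Sum.map (λ fU≡⊥ → f-inj (trans fU≡⊥ (sym f⊥))) (λ fV≡⊥ → f-inj (trans fV≡⊥ (sym f⊥)))
      (con (∈-map⁺ f U∈) (∈-map⁺ f V∈) (trans (sym (f∩ U V)) (trans (cong f U∩V≡⊥) f⊥))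
           (trans (sym (f∪ U V)) (cong f U∪V≡Y)))
  preimage : ∀ {W W'} → IsConnected R Y → ∃[ U ] U ∈ R × W ≡ f U → ∃[ V ] V ∈ R × W' ≡ f V →
    W ∩ W' ≡ ⊥ → W ∪ W' ≡ f Y → W ≡ ⊥ ⊎ W' ≡ ⊥
  preimage con (U , U∈ , refl) (V , V∈ , refl) fU∩fV≡⊥ fU∪fV≡fY =
    Sum.map (λ U≡⊥ → trans (cong f U≡⊥) f⊥) (λ V≡⊥ → trans (cong f V≡⊥) f⊥)
      (con U∈ V∈ (f-inj (trans (f∩ U V) (trans fU∩fV≡⊥ (sym f⊥)))) (f-inj (trans (f∪ U V) fU∪fV≡fY)))
  preserve : IsConnected R Y → IsConnected (map f R) (f Y)
  preserve con W∈ W'∈ = preimage con (∈-map⁻ f W∈) (∈-map⁻ f W'∈)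

record Admissible (F F' : Family n) : Set where
  field
    coarser             : F ⊆ F'
    agrees-on-connected : ∀ Y → IsConnected (restrict F' Y) Y → restrict F' Y ≈ restrict F Y
    same-classes        : ∀ x y → sim (quotient F F') x y ≡ sim (quotient F' F') x y

T-admissible : {F F' : Family n} → T (admissible F F') ⇔ Admissible F F'
T-admissible {n} {F} {F'} = mk⇔
  (λ h → let fin , agr , cls = to axioms h in record
    { coarser             = λ U∈F → to T-memᵇ (fin U∈F)
    ; agrees-on-connected = λ Y Ycon →
        to T-famEq (to (T-implies {connected F' Y}) (agr (∈-allSubsets Y)) (from T-connected Ycon))
    ; same-classes        = λ x y → to T-⇔ᵇ (cls (∈-allFin x) (∈-allFin y)) })
  (λ adm → let open Admissible adm in from axioms
    ( from T-memᵇ ∘ coarser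
    , (λ {Y} _ → from T-implies (from T-famEq ∘ agrees-on-connected Y ∘ to T-connected))
    , λ {x} {y} _ _ → from T-⇔ᵇ (same-classes x y) ))
  where
  axioms = T-all _ F ∧-⇔ T-all _ (allSubsets n) ∧-⇔ T-all² _ (allFin n)

Admissible-resp-≈ : {F F' G' : Family n} → F' ≈ G' → Admissible F F' → Admissible F G'
Admissible-resp-≈ {F = F} F'≈G' adm = record
  { coarser = proj₁ F'≈G' ∘ coarser
  ; agrees-on-connected = λ Y Ycon → ≈-trans (map-resp-≈ (_∩ Y) (≈-sym F'≈G'))
      (agrees-on-connected Y (IsConnected-resp-≈ (map-resp-≈ (_∩ Y) (≈-sym F'≈G')) Ycon))
  ; same-classes = λ x y → trans (sim-resp-≈ (quotient-resp-≈ (≈-refl {F = F}) (≈-sym F'≈G')) x y)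
      (trans (same-classes x y) (sim-resp-≈ (quotient-resp-≈ F'≈G' F'≈G') x y)) }
  where open Admissible adm

admissible-resp-≈ : {F F' G' : Family n} → F' ≈ G' → admissible F F' ≡ admissible F G'
admissible-resp-≈ {F = F} F'≈G' = ≡-by-reflection (T-admissible {F = F}) T-admissible
  (Admissible-resp-≈ F'≈G') (Admissible-resp-≈ (≈-sym F'≈G'))

-- Coefficients of Γ

occursInΓ : Family n → Family n → Family n → Bool
occursInΓ F A B = isTopology A ∧ admissible F A ∧ famEq (quotient F A) B

OccursInΓ : Family n → Family n → Family n → Set
OccursInΓ F A B = IsTopology A × Admissible F A × quotient F A ≈ B

T-occursInΓ : {F A B : Family n} → T (occursInΓ F A B) ⇔ OccursInΓ F A B
T-occursInΓ = T-isTopology ∧-⇔ T-admissible ∧-⇔ T-famEq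

occursInΓ-resp-≈ : {F S A B : Family n} → S ≈ A → occursInΓ F S B ≡ occursInΓ F A B
occursInΓ-resp-≈ {F = F} {B = B} S≈A =
  cong₂ _∧_ (isTopology-resp-≈ S≈A) (cong₂ _∧_ (admissible-resp-≈ {F = F} S≈A)
    (famEq-resp-≈ (quotient-resp-≈ (≈-refl {F = F}) S≈A) (≈-refl {F = B})))

count : (A → Bool) → List A → ℕ
count p xs = length (filterᵇ p xs)

ind : Bool → ℕ
ind b = if b then 1 else 0

ind-∧∧ : ∀ a b c → ind ((a ∧ b) ∧ c) ≡ ind a * ind b * ind c
ind-∧∧ false b     c = refl
ind-∧∧ true  false c = refl
ind-∧∧ true  true  c = sym (+-identityʳ (ind c))

count-∷ : (p : A → Bool) (x : A) (xs : List A) → count p (x ∷ xs) ≡ ind (p x) + count p xs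
count-∷ p x xs with p x
... | true  = refl
... | false = refl

count-∧ˡ : (b : Bool) (p : A → Bool) (xs : List A) → count (λ x → b ∧ p x) xs ≡ ind b * count p xs
count-∧ˡ true  p xs = sym (+-identityʳ (count p xs))
count-∧ˡ false p xs = count-false xs
  where
  count-false : ∀ xs → count (const false) xs ≡ 0
  count-false []       = refl
  count-false (_ ∷ xs) = count-false xs

count-++ : (p : A → Bool) (xs ys : List A) → count p (xs ++ ys) ≡ count p xs + count p ys
count-++ p xs ys = trans (cong length (filter-++ (T? ∘ p) xs ys)) (length-++ (filterᵇ p xs))

count-map : (p : B → Bool) (f : A → B) (xs : List A) → count p (map f xs) ≡ count (p ∘ f) xs
count-map p f []       = refl
count-map p f (x ∷ xs) = trans (count-∷ p (f x) (map f xs))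
  (trans (cong (ind (p (f x)) +_) (count-map p f xs)) (sym (count-∷ (p ∘ f) x xs)))

count-filterᵇ : (p q : A → Bool) (xs : List A) → count p (filterᵇ q xs) ≡ count (λ x → q x ∧ p x) xs
count-filterᵇ p q []       = refl
count-filterᵇ p q (x ∷ xs) = trans head (sym (count-∷ (λ x → q x ∧ p x) x xs))
  where
  head : count p (filterᵇ q (x ∷ xs)) ≡ ind (q x ∧ p x) + count (λ x → q x ∧ p x) xs
  head with q x
  ... | true  = trans (count-∷ p x (filterᵇ q xs)) (cong (ind (p x) +_) (count-filterᵇ p q xs))
  ... | false = count-filterᵇ p q xs

count-cong : {p q : A → Bool} (xs : List A) → (∀ {x} → x ∈ xs → p x ≡ q x) → count p xs ≡ count q xs
count-cong []       _   = refl
count-cong {p = p} {q} (x ∷ xs) p≡q = trans (count-∷ p x xs)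
  (trans (cong₂ _+_ (cong ind (p≡q (Any.here refl))) (count-cong xs (p≡q ∘ Any.there)))
    (sym (count-∷ q x xs)))

count-pairs : (r : C → Bool) (f : A → B → C) (p : A → Bool) (q : B → Bool) (xs : List A) (ys : List B) →
  (∀ {x y} → x ∈ xs → y ∈ ys → r (f x y) ≡ p x ∧ q y) →
  count r (concatMap (λ x → map (f x) ys) xs) ≡ count p xs * count q ys
count-pairs r f p q []       ys r≡ = refl
count-pairs r f p q (x ∷ xs) ys r≡ = begin
  count r (map (f x) ys ++ concatMap (λ x → map (f x) ys) xs)
    ≡⟨ count-++ r (map (f x) ys) _ ⟩
  count r (map (f x) ys) + count r (concatMap (λ x → map (f x) ys) xs)
    ≡⟨ cong₂ _+_ (trans (count-map r (f x) ys) (count-cong ys (r≡ (Any.here refl))))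
                 (count-pairs r f p q xs ys (r≡ ∘ Any.there)) ⟩
  count (λ y → p x ∧ q y) ys + count p xs * count q ys
    ≡⟨ cong (_+ count p xs * count q ys) (count-∧ˡ (p x) q ys) ⟩
  ind (p x) * count q ys + count p xs * count q ys
    ≡⟨ *-distribʳ-+ (count q ys) (ind (p x)) (count p xs) ⟨
  (ind (p x) + count p xs) * count q ys
    ≡⟨ cong (_* count q ys) (count-∷ p x xs) ⟨
  count p (x ∷ xs) * count q ys ∎
  where open ≡-Reasoning

sublists-⊆ : (xs : List A) {S : List A} → S ∈ sublists xs → S ⊆ xs
sublists-⊆ [] (Any.here refl) ()
sublists-⊆ (x ∷ xs) S∈ with ∈-++⁻ (map (x ∷_) (sublists xs)) S∈
... | inj₂ S∈′ = Any.there ∘ sublists-⊆ xs S∈′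
... | inj₁ S∈′ with ∈-map⁻ (x ∷_) S∈′
... | S′ , S′∈ , refl = λ { (Any.here refl) → Any.here refl
                         ; (Any.there y∈)  → Any.there (sublists-⊆ xs S′∈ y∈) }

allSubsets-unique : ∀ n → Unique (allSubsets n)
allSubsets-unique zero    = All.[] ∷ []
allSubsets-unique (suc n) = Unique.++⁺ (Unique.map⁺ ∷-injectiveʳ (allSubsets-unique n))
                                      (Unique.map⁺ ∷-injectiveʳ (allSubsets-unique n)) disjoint
  where
  disjoint : Disjoint (map (true ∷_) (allSubsets n)) (map (false ∷_) (allSubsets n))
  disjoint (v∈ , v∈′) with ∈-map⁻ (true ∷_) v∈ | ∈-map⁻ (false ∷_) v∈′
  ... | _ , _ , refl | _ , _ , ()

-- A sublist of a duplicate-free L is determined by which members of L it contains.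
count-exact-sublist : (L : List (Subset n)) → Unique L → (Q : Subset n → Bool) →
  count (λ S → all (λ Y → memᵇ Y S ⇔ᵇ Q Y) L) (sublists L) ≡ 1
count-exact-sublist []       []             Q = refl
count-exact-sublist {n} (x ∷ xs) (x∉xs ∷ uniq) Q = begin
  count P (map (x ∷_) (sublists xs) ++ sublists xs)
    ≡⟨ count-++ P (map (x ∷_) (sublists xs)) (sublists xs) ⟩
  count P (map (x ∷_) (sublists xs)) + count P (sublists xs)
    ≡⟨ cong (_+ count P (sublists xs)) (count-map P (x ∷_) (sublists xs)) ⟩
  count (P ∘ (x ∷_)) (sublists xs) + count P (sublists xs)
    ≡⟨ cong₂ _+_ (count-cong (sublists xs) with-x) (count-cong (sublists xs) without-x) ⟩
  count (λ S → Q x ∧ P′ S) (sublists xs) + count (λ S → not (Q x) ∧ P′ S) (sublists xs)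
    ≡⟨ cong₂ _+_ (count-∧ˡ (Q x) P′ (sublists xs)) (count-∧ˡ (not (Q x)) P′ (sublists xs)) ⟩
  ind (Q x) * count P′ (sublists xs) + ind (not (Q x)) * count P′ (sublists xs)
    ≡⟨ cong (λ c → ind (Q x) * c + ind (not (Q x)) * c) (count-exact-sublist xs uniq Q) ⟩
  ind (Q x) * 1 + ind (not (Q x)) * 1
    ≡⟨ excluded-middle (Q x) ⟩
  1 ∎
  where
  open ≡-Reasoning
  P P′ : List (Subset n) → Bool
  P  S = all (λ Y → memᵇ Y S ⇔ᵇ Q Y) (x ∷ xs)
  P′ S = all (λ Y → memᵇ Y S ⇔ᵇ Q Y) xs
  x∉ : ∀ {S} → S ∈ sublists xs → x ∉ S
  x∉ S∈ x∈S = All.lookup x∉xs (sublists-⊆ xs S∈ x∈S) refl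
  with-x : ∀ {S} → S ∈ sublists xs → P (x ∷ S) ≡ Q x ∧ P′ S
  with-x {S} _ = cong₂ _∧_ (trans (cong (_⇔ᵇ Q x) (memᵇ-here x S)) (true-⇔ᵇ (Q x)))
    (all-cong xs λ {Y} Y∈ → cong (_⇔ᵇ Q Y) (memᵇ-there {F = S} (All.lookup x∉xs Y∈ ∘ sym)))
  without-x : ∀ {S} → S ∈ sublists xs → P S ≡ not (Q x) ∧ P′ S
  without-x {S} S∈ = cong (_∧ P′ S)
    (trans (cong (_⇔ᵇ Q x) (¬T⇒≡false (x∉ S∈ ∘ to T-memᵇ))) (false-⇔ᵇ (Q x)))
  excluded-middle : ∀ b → ind b * 1 + ind (not b) * 1 ≡ 1
  excluded-middle false = refl
  excluded-middle true  = refl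

count-famEq : (𝒜 : Family n) (Φ : Family n → Bool) → (∀ {S} → S ≈ 𝒜 → Φ S ≡ Φ 𝒜) →
  count (λ S → famEq S 𝒜 ∧ Φ S) (sublists (allSubsets n)) ≡ ind (Φ 𝒜)
count-famEq {n} 𝒜 Φ Φ-resp-≈ = begin
  count (λ S → famEq S 𝒜 ∧ Φ S) (sublists (allSubsets n))
    ≡⟨ count-cong (sublists (allSubsets n)) (λ {S} _ → swap S) ⟩
  count (λ S → Φ 𝒜 ∧ famEq S 𝒜) (sublists (allSubsets n))
    ≡⟨ count-∧ˡ (Φ 𝒜) (λ S → famEq S 𝒜) (sublists (allSubsets n)) ⟩
  ind (Φ 𝒜) * count (λ S → famEq S 𝒜) (sublists (allSubsets n))
    ≡⟨ cong (ind (Φ 𝒜) *_) (count-exact-sublist (allSubsets n) (allSubsets-unique n) (λ Y → memᵇ Y 𝒜)) ⟩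
  ind (Φ 𝒜) * 1
    ≡⟨ *-identityʳ (ind (Φ 𝒜)) ⟩
  ind (Φ 𝒜) ∎
  where
  open ≡-Reasoning
  swap : ∀ S → famEq S 𝒜 ∧ Φ S ≡ Φ 𝒜 ∧ famEq S 𝒜
  swap S with famEq S 𝒜 in eq
  ... | true  = trans (Φ-resp-≈ (to T-famEq (subst T (sym eq) _))) (sym (∧-identityʳ (Φ 𝒜)))
  ... | false = sym (∧-zeroʳ (Φ 𝒜))

coeff-Γ : (F A B : Family n) → coeff A B (Γ F) ≡ ind (occursInΓ F A B)
coeff-Γ {n} F A B = begin
  coeff A B (Γ F)
    ≡⟨ count-map _ (λ S → S , quotient F S) (filterᵇ (admissible F) (topologies n)) ⟩
  count (λ S → famEq S A ∧ famEq (quotient F S) B) (filterᵇ (admissible F) (topologies n))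
    ≡⟨ count-filterᵇ _ (admissible F) (topologies n) ⟩
  count (λ S → admissible F S ∧ famEq S A ∧ famEq (quotient F S) B) (topologies n)
    ≡⟨ count-filterᵇ _ isTopology (sublists (allSubsets n)) ⟩
  count (λ S → isTopology S ∧ admissible F S ∧ famEq S A ∧ famEq (quotient F S) B) (sublists (allSubsets n))
    ≡⟨ count-cong (sublists (allSubsets n)) (λ {S} _ → reorder (isTopology S) (admissible F S) (famEq S A) _) ⟩
  count (λ S → famEq S A ∧ occursInΓ F S B) (sublists (allSubsets n))
    ≡⟨ count-famEq A (λ S → occursInΓ F S B) (occursInΓ-resp-≈ {F = F} {B = B}) ⟩
  ind (occursInΓ F A B) ∎
  where
  open ≡-Reasoning
  reorder : ∀ t a e q → t ∧ a ∧ e ∧ q ≡ e ∧ t ∧ a ∧ q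
  reorder = solve 4 (λ t a e q → t ⊕ a ⊕ e ⊕ q ⊜ e ⊕ t ⊕ a ⊕ q) refl

Γ-pointed : (F : Family n) {p : Family n × Family n} → p ∈ Γ F → Pointed (proj₁ p) × Pointed (proj₂ p)
Γ-pointed {n} F p∈ with ∈-map⁻ (λ S → S , quotient F S) p∈
... | S , S∈ , refl =
  let S∈topologies = proj₁ (to (∈-filterᵇ (admissible F) {topologies n}) S∈)
  in IsTopology.pointed (to T-isTopology (proj₂ (to (∈-filterᵇ isTopology {sublists (allSubsets n)}) S∈topologies)))
   , quotient-pointed F S

-- Topologies on X₁ ⊔ X₂

module Product (n₁ n₂ : ℕ) where

  private variable
    𝒜 : Family (n₁ + n₂)
    F₁ G₁ : Family n₁
    F₂ G₂ : Family n₂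
    Y₁ : Subset n₁
    Y₂ : Subset n₂

  take-drop-++ᵛ : (Y₁ : Vec A n₁) (Y₂ : Vec A n₂) →
    take n₁ (Y₁ ++ᵛ Y₂) ≡ Y₁ × drop n₁ (Y₁ ++ᵛ Y₂) ≡ Y₂
  take-drop-++ᵛ Y₁ Y₂ = ++-injective (take n₁ (Y₁ ++ᵛ Y₂)) Y₁ (take++drop≡id n₁ (Y₁ ++ᵛ Y₂))

  elim-++ᵛ : (P : Subset (n₁ + n₂) → Set) → (∀ Y₁ Y₂ → P (Y₁ ++ᵛ Y₂)) → ∀ Y → P Y
  elim-++ᵛ P P-++ᵛ Y = subst P (take++drop≡id n₁ Y) (P-++ᵛ (take n₁ Y) (drop n₁ Y))

  replicate-++ᵛ : ∀ {m} (x : A) → replicate (m + n₂) x ≡ replicate m x ++ᵛ replicate n₂ x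
  replicate-++ᵛ {m = zero}  x = refl
  replicate-++ᵛ {m = suc m} x = cong (x ∷_) (replicate-++ᵛ x)

  ⊥-++ᵛ : ⊥ {n₁ + n₂} ≡ ⊥ {n₁} ++ᵛ ⊥ {n₂}
  ⊥-++ᵛ = replicate-++ᵛ false

  ⊤-++ᵛ : ⊤ {n₁ + n₂} ≡ ⊤ {n₁} ++ᵛ ⊤ {n₂}
  ⊤-++ᵛ = replicate-++ᵛ true

  ∩-++ᵛ : (U₁ V₁ : Subset n₁) (U₂ V₂ : Subset n₂) →
    (U₁ ++ᵛ U₂) ∩ (V₁ ++ᵛ V₂) ≡ (U₁ ∩ V₁) ++ᵛ (U₂ ∩ V₂)
  ∩-++ᵛ U₁ V₁ U₂ V₂ = zipWith-++ _∧_ U₁ U₂ V₁ V₂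

  ∪-++ᵛ : (U₁ V₁ : Subset n₁) (U₂ V₂ : Subset n₂) →
    (U₁ ++ᵛ U₂) ∪ (V₁ ++ᵛ V₂) ≡ (U₁ ∪ V₁) ++ᵛ (U₂ ∪ V₂)
  ∪-++ᵛ U₁ V₁ U₂ V₂ = zipWith-++ _∨_ U₁ U₂ V₁ V₂

  ∈-prod : (F₁ : Family n₁) (F₂ : Family n₂) (Y₁ : Subset n₁) (Y₂ : Subset n₂) →
    Y₁ ++ᵛ Y₂ ∈ prod F₁ F₂ ⇔ (Y₁ ∈ F₁ × Y₂ ∈ F₂)
  ∈-prod F₁ F₂ Y₁ Y₂ = mk⇔
    (λ Y∈ → let Y₁∈ , Y₂∈ = to blocks (to (∈-filterᵇ-allSubsets _) Y∈)
            in subst (_∈ F₁) take≡ Y₁∈ , subst (_∈ F₂) drop≡ Y₂∈)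
    (λ (Y₁∈ , Y₂∈) → from (∈-filterᵇ-allSubsets _)
      (from blocks (subst (_∈ F₁) (sym take≡) Y₁∈ , subst (_∈ F₂) (sym drop≡) Y₂∈)))
    where
    Y = Y₁ ++ᵛ Y₂
    blocks = T-memᵇ {Y = take n₁ Y} {F₁} ∧-⇔ T-memᵇ {Y = drop n₁ Y} {F₂}
    take≡ = proj₁ (take-drop-++ᵛ Y₁ Y₂)
    drop≡ = proj₂ (take-drop-++ᵛ Y₁ Y₂)

  prod-resp-⊆ : F₁ ⊆ G₁ → F₂ ⊆ G₂ → prod F₁ F₂ ⊆ prod G₁ G₂
  prod-resp-⊆ {F₁ = F₁} {G₁} {F₂} {G₂} F₁⊆G₁ F₂⊆G₂ {Y} Y∈ with Vec.splitAt n₁ Y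
  ... | Y₁ , Y₂ , refl =
    let Y₁∈ , Y₂∈ = to (∈-prod F₁ F₂ Y₁ Y₂) Y∈ in from (∈-prod G₁ G₂ Y₁ Y₂) (F₁⊆G₁ Y₁∈ , F₂⊆G₂ Y₂∈)

  prod-resp-≈ : F₁ ≈ G₁ → F₂ ≈ G₂ → prod F₁ F₂ ≈ prod G₁ G₂
  prod-resp-≈ (F₁⊆G₁ , G₁⊆F₁) (F₂⊆G₂ , G₂⊆F₂) =
    prod-resp-⊆ F₁⊆G₁ F₂⊆G₂ , prod-resp-⊆ G₁⊆F₁ G₂⊆F₂

  IsTopology-prod : IsTopology F₁ → IsTopology F₂ → IsTopology (prod F₁ F₂)
  IsTopology-prod {F₁ = F₁} {F₂ = F₂} top₁ top₂ = record
    { pointed  = record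
        { ⊥∈ = subst (_∈ prod F₁ F₂) (sym ⊥-++ᵛ) (from (∈-prod F₁ F₂ ⊥ ⊥) (T₁.⊥∈ , T₂.⊥∈))
        ; ⊤∈ = subst (_∈ prod F₁ F₂) (sym ⊤-++ᵛ) (from (∈-prod F₁ F₂ ⊤ ⊤) (T₁.⊤∈ , T₂.⊤∈)) }
    ; ∩-closed = closed _∩_ ∩-++ᵛ T₁.∩-closed T₂.∩-closed
    ; ∪-closed = closed _∪_ ∪-++ᵛ T₁.∪-closed T₂.∪-closed }
    where
    module T₁ = IsTopology top₁
    module T₂ = IsTopology top₂
    closed : (_∙_ : ∀ {m} → Subset m → Subset m → Subset m) →
      (∀ U₁ V₁ U₂ V₂ → (U₁ ++ᵛ U₂) ∙ (V₁ ++ᵛ V₂) ≡ (U₁ ∙ V₁) ++ᵛ (U₂ ∙ V₂)) →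
      (∀ {U V} → U ∈ F₁ → V ∈ F₁ → U ∙ V ∈ F₁) →
      (∀ {U V} → U ∈ F₂ → V ∈ F₂ → U ∙ V ∈ F₂) →
      ∀ {U V} → U ∈ prod F₁ F₂ → V ∈ prod F₁ F₂ → U ∙ V ∈ prod F₁ F₂
    closed _∙_ ∙-++ᵛ closed₁ closed₂ {U} {V} U∈ V∈ with Vec.splitAt n₁ U | Vec.splitAt n₁ V
    ... | U₁ , U₂ , refl | V₁ , V₂ , refl =
      let U₁∈ , U₂∈ = to (∈-prod F₁ F₂ U₁ U₂) U∈
          V₁∈ , V₂∈ = to (∈-prod F₁ F₂ V₁ V₂) V∈
      in subst (_∈ prod F₁ F₂) (sym (∙-++ᵛ U₁ V₁ U₂ V₂))
           (from (∈-prod F₁ F₂ _ _) (closed₁ U₁∈ V₁∈ , closed₂ U₂∈ V₂∈))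

  projˡ : Family (n₁ + n₂) → Family n₁
  projˡ = map (take n₁)

  projʳ : Family (n₁ + n₂) → Family n₂
  projʳ = map (drop n₁)

  IsProduct : Family (n₁ + n₂) → Set
  IsProduct 𝒜 = prod (projˡ 𝒜) (projʳ 𝒜) ≈ 𝒜

  isProduct : Family (n₁ + n₂) → Bool
  isProduct 𝒜 = famEq (prod (projˡ 𝒜) (projʳ 𝒜)) 𝒜

  ∈-projˡ : {𝒜 : Family (n₁ + n₂)} {Y₁ : Subset n₁} → Y₁ ∈ projˡ 𝒜 ⇔ (∃[ Y₂ ] Y₁ ++ᵛ Y₂ ∈ 𝒜)
  ∈-projˡ {𝒜} {Y₁} = mk⇔
    (λ Y₁∈ → let Z , Z∈ , Y₁≡ = ∈-map⁻ (take n₁) Y₁∈ in split Z Z∈ Y₁≡)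
    (λ (Y₂ , Y∈) → subst (_∈ projˡ 𝒜) (proj₁ (take-drop-++ᵛ Y₁ Y₂)) (∈-map⁺ (take n₁) Y∈))
    where
    split : ∀ Z → Z ∈ 𝒜 → Y₁ ≡ take n₁ Z → ∃[ Y₂ ] Y₁ ++ᵛ Y₂ ∈ 𝒜
    split Z Z∈ Y₁≡ =
      drop n₁ Z , subst (_∈ 𝒜) (sym (trans (cong (_++ᵛ drop n₁ Z) Y₁≡) (take++drop≡id n₁ Z))) Z∈

  ∈-projʳ : {𝒜 : Family (n₁ + n₂)} {Y₂ : Subset n₂} → Y₂ ∈ projʳ 𝒜 ⇔ (∃[ Y₁ ] Y₁ ++ᵛ Y₂ ∈ 𝒜)
  ∈-projʳ {𝒜} {Y₂} = mk⇔
    (λ Y₂∈ → let Z , Z∈ , Y₂≡ = ∈-map⁻ (drop n₁) Y₂∈ in split Z Z∈ Y₂≡)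
    (λ (Y₁ , Y∈) → subst (_∈ projʳ 𝒜) (proj₂ (take-drop-++ᵛ Y₁ Y₂)) (∈-map⁺ (drop n₁) Y∈))
    where
    split : ∀ Z → Z ∈ 𝒜 → Y₂ ≡ drop n₁ Z → ∃[ Y₁ ] Y₁ ++ᵛ Y₂ ∈ 𝒜
    split Z Z∈ Y₂≡ =
      take n₁ Z , subst (_∈ 𝒜) (sym (trans (cong (take n₁ Z ++ᵛ_) Y₂≡) (take++drop≡id n₁ Z))) Z∈

  projˡ-prod : ⊥ ∈ F₂ → projˡ (prod F₁ F₂) ≈ F₁
  projˡ-prod {F₂ = F₂} {F₁ = F₁} ⊥∈F₂ =
      (λ Y₁∈ → let Y₂ , Y∈ = to ∈-projˡ Y₁∈ in proj₁ (to (∈-prod F₁ F₂ _ Y₂) Y∈))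
    , (λ Y₁∈ → from ∈-projˡ (⊥ , from (∈-prod F₁ F₂ _ ⊥) (Y₁∈ , ⊥∈F₂)))

  projʳ-prod : ⊥ ∈ F₁ → projʳ (prod F₁ F₂) ≈ F₂
  projʳ-prod {F₁ = F₁} {F₂ = F₂} ⊥∈F₁ =
      (λ Y₂∈ → let Y₁ , Y∈ = to ∈-projʳ Y₂∈ in proj₂ (to (∈-prod F₁ F₂ Y₁ _) Y∈))
    , (λ Y₂∈ → from ∈-projʳ (⊥ , from (∈-prod F₁ F₂ ⊥ _) (⊥∈F₁ , Y₂∈)))

  X₁ X₂ : Subset (n₁ + n₂)
  X₁ = ⊤ {n₁} ++ᵛ ⊥ {n₂}
  X₂ = ⊥ {n₁} ++ᵛ ⊤ {n₂}

  blocks-recombine : (Y₁ W₁ : Subset n₁) (Y₂ W₂ : Subset n₂) →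
    ((Y₁ ++ᵛ W₂) ∩ X₁) ∪ ((W₁ ++ᵛ Y₂) ∩ X₂) ≡ Y₁ ++ᵛ Y₂
  blocks-recombine Y₁ W₁ Y₂ W₂ = begin
    ((Y₁ ++ᵛ W₂) ∩ X₁) ∪ ((W₁ ++ᵛ Y₂) ∩ X₂)
      ≡⟨ cong₂ _∪_ (∩-++ᵛ Y₁ ⊤ W₂ ⊥) (∩-++ᵛ W₁ ⊥ Y₂ ⊤) ⟩
    ((Y₁ ∩ ⊤) ++ᵛ (W₂ ∩ ⊥)) ∪ ((W₁ ∩ ⊥) ++ᵛ (Y₂ ∩ ⊤))
      ≡⟨ cong₂ _∪_ (cong₂ _++ᵛ_ (∩-identityʳ Y₁) (∩-zeroʳ W₂))
                   (cong₂ _++ᵛ_ (∩-zeroʳ W₁) (∩-identityʳ Y₂)) ⟩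
    (Y₁ ++ᵛ ⊥) ∪ (⊥ {n₁} ++ᵛ Y₂)
      ≡⟨ ∪-++ᵛ Y₁ ⊥ ⊥ Y₂ ⟩
    (Y₁ ∪ ⊥) ++ᵛ (⊥ ∪ Y₂)
      ≡⟨ cong₂ _++ᵛ_ (∪-identityʳ Y₁) (∪-identityˡ Y₂) ⟩
    Y₁ ++ᵛ Y₂ ∎
    where open ≡-Reasoning

  prod-proj : IsTopology 𝒜 → X₁ ∈ 𝒜 → X₂ ∈ 𝒜 → IsProduct 𝒜
  prod-proj {𝒜} top X₁∈ X₂∈ = prod⊆𝒜 , 𝒜⊆prod
    where
    open IsTopology top
    prod⊆𝒜 : prod (projˡ 𝒜) (projʳ 𝒜) ⊆ 𝒜
    prod⊆𝒜 {Y} = elim-++ᵛ (λ Y → Y ∈ prod (projˡ 𝒜) (projʳ 𝒜) → Y ∈ 𝒜) (λ Y₁ Y₂ Y∈ →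
      let Y₁∈ , Y₂∈ = to (∈-prod _ _ Y₁ Y₂) Y∈
          W₂ , Y₁W₂∈ = to ∈-projˡ Y₁∈
          W₁ , W₁Y₂∈ = to ∈-projʳ Y₂∈
      in subst (_∈ 𝒜) (blocks-recombine Y₁ W₁ Y₂ W₂)
           (∪-closed (∩-closed Y₁W₂∈ X₁∈) (∩-closed W₁Y₂∈ X₂∈))) Y
    𝒜⊆prod : 𝒜 ⊆ prod (projˡ 𝒜) (projʳ 𝒜)
    𝒜⊆prod {Y} = elim-++ᵛ (λ Y → Y ∈ 𝒜 → Y ∈ prod (projˡ 𝒜) (projʳ 𝒜)) (λ Y₁ Y₂ Y∈ →
      from (∈-prod _ _ Y₁ Y₂) (from ∈-projˡ (Y₂ , Y∈) , from ∈-projʳ (Y₁ , Y∈))) Y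

  IsTopology-projˡ : IsTopology 𝒜 → IsTopology (projˡ 𝒜)
  IsTopology-projˡ {𝒜} top = record
    { pointed  = record { ⊥∈ = from ∈-projˡ (⊥ , subst (_∈ 𝒜) ⊥-++ᵛ ⊥∈)
                        ; ⊤∈ = from ∈-projˡ (⊤ , subst (_∈ 𝒜) ⊤-++ᵛ ⊤∈) }
    ; ∩-closed = λ U∈ V∈ → let U₂ , U∈𝒜 = to ∈-projˡ U∈ ; V₂ , V∈𝒜 = to ∈-projˡ V∈
                           in from ∈-projˡ (U₂ ∩ V₂ , subst (_∈ 𝒜) (∩-++ᵛ _ _ U₂ V₂) (∩-closed U∈𝒜 V∈𝒜))
    ; ∪-closed = λ U∈ V∈ → let U₂ , U∈𝒜 = to ∈-projˡ U∈ ; V₂ , V∈𝒜 = to ∈-projˡ V∈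
                           in from ∈-projˡ (U₂ ∪ V₂ , subst (_∈ 𝒜) (∪-++ᵛ _ _ U₂ V₂) (∪-closed U∈𝒜 V∈𝒜)) }
    where open IsTopology top

  IsTopology-projʳ : IsTopology 𝒜 → IsTopology (projʳ 𝒜)
  IsTopology-projʳ {𝒜} top = record
    { pointed  = record { ⊥∈ = from ∈-projʳ (⊥ , subst (_∈ 𝒜) ⊥-++ᵛ ⊥∈)
                        ; ⊤∈ = from ∈-projʳ (⊤ , subst (_∈ 𝒜) ⊤-++ᵛ ⊤∈) }
    ; ∩-closed = λ U∈ V∈ → let U₁ , U∈𝒜 = to ∈-projʳ U∈ ; V₁ , V∈𝒜 = to ∈-projʳ V∈
                           in from ∈-projʳ (U₁ ∩ V₁ , subst (_∈ 𝒜) (∩-++ᵛ U₁ V₁ _ _) (∩-closed U∈𝒜 V∈𝒜))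
    ; ∪-closed = λ U∈ V∈ → let U₁ , U∈𝒜 = to ∈-projʳ U∈ ; V₁ , V∈𝒜 = to ∈-projʳ V∈
                           in from ∈-projʳ (U₁ ∪ V₁ , subst (_∈ 𝒜) (∪-++ᵛ U₁ V₁ _ _) (∪-closed U∈𝒜 V∈𝒜)) }
    where open IsTopology top

  prod-≈-iff : {S₁ : Family n₁} {S₂ : Family n₂} → ⊥ ∈ S₁ → ⊥ ∈ S₂ →
    prod S₁ S₂ ≈ 𝒜 ⇔ ((S₁ ≈ projˡ 𝒜 × S₂ ≈ projʳ 𝒜) × IsProduct 𝒜)
  prod-≈-iff {𝒜} {S₁} {S₂} ⊥∈S₁ ⊥∈S₂ = mk⇔
    (λ S≈𝒜 → let S₁≈ = ≈-trans (≈-sym (projˡ-prod ⊥∈S₂)) (map-resp-≈ (take n₁) S≈𝒜)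
                 S₂≈ = ≈-trans (≈-sym (projʳ-prod ⊥∈S₁)) (map-resp-≈ (drop n₁) S≈𝒜)
             in (S₁≈ , S₂≈) , ≈-trans (prod-resp-≈ (≈-sym S₁≈) (≈-sym S₂≈)) S≈𝒜)
    (λ ((S₁≈ , S₂≈) , split) → ≈-trans (prod-resp-≈ S₁≈ S₂≈) split)

  elim-↑ : (P : Fin (n₁ + n₂) → Set) → (∀ i → P (i ↑ˡ n₂)) → (∀ j → P (n₁ ↑ʳ j)) → ∀ x → P x
  elim-↑ P P-inl P-inr x with Fin.splitAt n₁ x in eq
  ... | inj₁ i = subst P (splitAt⁻¹-↑ˡ eq) (P-inl i)
  ... | inj₂ j = subst P (splitAt⁻¹-↑ʳ eq) (P-inr j)

  elim-↑² : (P : Fin (n₁ + n₂) → Fin (n₁ + n₂) → Set) →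
    (∀ i j → P (i ↑ˡ n₂) (j ↑ˡ n₂)) → (∀ i j → P (i ↑ˡ n₂) (n₁ ↑ʳ j)) →
    (∀ i j → P (n₁ ↑ʳ i) (j ↑ˡ n₂)) → (∀ i j → P (n₁ ↑ʳ i) (n₁ ↑ʳ j)) → ∀ x y → P x y
  elim-↑² P ll lr rl rr x y =
    elim-↑ (λ x → P x y) (λ i → elim-↑ (P (i ↑ˡ n₂)) (ll i) (lr i) y)
                         (λ i → elim-↑ (P (n₁ ↑ʳ i)) (rl i) (rr i) y) x

  X₁-inl : ∀ i → T (lookup X₁ (i ↑ˡ n₂))
  X₁-inl i = subst T (sym (trans (lookup-++ˡ ⊤ ⊥ i) (lookup-replicate i true))) _

  X₁-inr : ∀ j → ¬ T (lookup X₁ (n₁ ↑ʳ j))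
  X₁-inr j = subst T (trans (lookup-++ʳ (⊤ {n₁}) ⊥ j) (lookup-replicate j false))

  X₂-inl : ∀ i → ¬ T (lookup X₂ (i ↑ˡ n₂))
  X₂-inl i = subst T (trans (lookup-++ˡ ⊥ ⊤ i) (lookup-replicate i false))

  X₂-inr : ∀ j → T (lookup X₂ (n₁ ↑ʳ j))
  X₂-inr j = subst T (sym (trans (lookup-++ʳ (⊥ {n₁}) ⊤ j) (lookup-replicate j true))) _

  module _ (F₁ : Family n₁) (F₂ : Family n₂) where

    ≤-prod-inl : ⊥ ∈ F₂ → ∀ i j → (i ↑ˡ n₂) ≤[ prod F₁ F₂ ] (j ↑ˡ n₂) ⇔ i ≤[ F₁ ] j
    ≤-prod-inl ⊥∈F₂ i j = mk⇔
      (λ x≤y {U} U∈F₁ Ui → subst T (lookup-++ˡ U ⊥ j)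
          (x≤y (from (∈-prod F₁ F₂ U ⊥) (U∈F₁ , ⊥∈F₂)) (subst T (sym (lookup-++ˡ U ⊥ i)) Ui)))
      (λ i≤j {W} → elim-++ᵛ (λ W → W ∈ prod F₁ F₂ → T (lookup W (i ↑ˡ n₂)) → T (lookup W (j ↑ˡ n₂)))
          (λ W₁ W₂ W∈ Wi → subst T (sym (lookup-++ˡ W₁ W₂ j))
            (i≤j (proj₁ (to (∈-prod F₁ F₂ W₁ W₂) W∈)) (subst T (lookup-++ˡ W₁ W₂ i) Wi))) W)

    ≤-prod-inr : ⊥ ∈ F₁ → ∀ i j → (n₁ ↑ʳ i) ≤[ prod F₁ F₂ ] (n₁ ↑ʳ j) ⇔ i ≤[ F₂ ] j
    ≤-prod-inr ⊥∈F₁ i j = mk⇔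
      (λ x≤y {U} U∈F₂ Ui → subst T (lookup-++ʳ (⊥ {n₁}) U j)
          (x≤y (from (∈-prod F₁ F₂ ⊥ U) (⊥∈F₁ , U∈F₂)) (subst T (sym (lookup-++ʳ (⊥ {n₁}) U i)) Ui)))
      (λ i≤j {W} → elim-++ᵛ (λ W → W ∈ prod F₁ F₂ → T (lookup W (n₁ ↑ʳ i)) → T (lookup W (n₁ ↑ʳ j)))
          (λ W₁ W₂ W∈ Wi → subst T (sym (lookup-++ʳ W₁ W₂ j))
            (i≤j (proj₂ (to (∈-prod F₁ F₂ W₁ W₂) W∈)) (subst T (lookup-++ʳ W₁ W₂ i) Wi))) W)

    ≰-prod-inl-inr : X₁ ∈ prod F₁ F₂ → ∀ i j → ¬ (i ↑ˡ n₂) ≤[ prod F₁ F₂ ] (n₁ ↑ʳ j)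
    ≰-prod-inl-inr X₁∈ i j x≤y = X₁-inr j (x≤y X₁∈ (X₁-inl i))

    ≰-prod-inr-inl : X₂ ∈ prod F₁ F₂ → ∀ i j → ¬ (n₁ ↑ʳ i) ≤[ prod F₁ F₂ ] (j ↑ˡ n₂)
    ≰-prod-inr-inl X₂∈ i j x≤y = X₂-inl j (x≤y X₂∈ (X₂-inr i))

    X₁∈prod : Pointed F₁ → Pointed F₂ → X₁ ∈ prod F₁ F₂
    X₁∈prod p₁ p₂ = from (∈-prod F₁ F₂ ⊤ ⊥) (Pointed.⊤∈ p₁ , Pointed.⊥∈ p₂)

    X₂∈prod : Pointed F₁ → Pointed F₂ → X₂ ∈ prod F₁ F₂
    X₂∈prod p₁ p₂ = from (∈-prod F₁ F₂ ⊥ ⊤) (Pointed.⊥∈ p₁ , Pointed.⊤∈ p₂)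

    sim-prod-inl : ⊥ ∈ F₂ → ∀ i j → sim (prod F₁ F₂) (i ↑ˡ n₂) (j ↑ˡ n₂) ≡ sim F₁ i j
    sim-prod-inl ⊥∈F₂ i j = cong₂ _∧_ (leq-inl i j) (leq-inl j i)
      where
      leq-inl : ∀ i j → leq (prod F₁ F₂) (i ↑ˡ n₂) (j ↑ˡ n₂) ≡ leq F₁ i j
      leq-inl i j = ≡-by-reflection T-leq T-leq (to (≤-prod-inl ⊥∈F₂ i j)) (from (≤-prod-inl ⊥∈F₂ i j))

    sim-prod-inr : ⊥ ∈ F₁ → ∀ i j → sim (prod F₁ F₂) (n₁ ↑ʳ i) (n₁ ↑ʳ j) ≡ sim F₂ i j
    sim-prod-inr ⊥∈F₁ i j = cong₂ _∧_ (leq-inr i j) (leq-inr j i)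
      where
      leq-inr : ∀ i j → leq (prod F₁ F₂) (n₁ ↑ʳ i) (n₁ ↑ʳ j) ≡ leq F₂ i j
      leq-inr i j = ≡-by-reflection T-leq T-leq (to (≤-prod-inr ⊥∈F₁ i j)) (from (≤-prod-inr ⊥∈F₁ i j))

    sim-prod-inl-inr : X₁ ∈ prod F₁ F₂ → ∀ i j → sim (prod F₁ F₂) (i ↑ˡ n₂) (n₁ ↑ʳ j) ≡ false
    sim-prod-inl-inr X₁∈ i j =
      cong (_∧ leq (prod F₁ F₂) (n₁ ↑ʳ j) (i ↑ˡ n₂)) (¬T⇒≡false (≰-prod-inl-inr X₁∈ i j ∘ to T-leq))

    sim-prod-inr-inl : X₂ ∈ prod F₁ F₂ → ∀ i j → sim (prod F₁ F₂) (n₁ ↑ʳ i) (j ↑ˡ n₂) ≡ false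
    sim-prod-inr-inl X₂∈ i j =
      cong (_∧ leq (prod F₁ F₂) (j ↑ˡ n₂) (n₁ ↑ʳ i)) (¬T⇒≡false (≰-prod-inr-inl X₂∈ i j ∘ to T-leq))

  sim-prod-cong : Pointed F₁ → Pointed F₂ → Pointed G₁ → Pointed G₂ →
    (∀ i j → sim F₁ i j ≡ sim G₁ i j) → (∀ i j → sim F₂ i j ≡ sim G₂ i j) →
    ∀ x y → sim (prod F₁ F₂) x y ≡ sim (prod G₁ G₂) x y
  sim-prod-cong {F₁ = F₁} {F₂ = F₂} {G₁ = G₁} {G₂ = G₂} pF₁ pF₂ pG₁ pG₂ same₁ same₂ = elim-↑² _
    (λ i j → trans (sim-prod-inl F₁ F₂ (Pointed.⊥∈ pF₂) i j)
               (trans (same₁ i j) (sym (sim-prod-inl G₁ G₂ (Pointed.⊥∈ pG₂) i j))))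
    (λ i j → trans (sim-prod-inl-inr F₁ F₂ (X₁∈prod F₁ F₂ pF₁ pF₂) i j)
               (sym (sim-prod-inl-inr G₁ G₂ (X₁∈prod G₁ G₂ pG₁ pG₂) i j)))
    (λ i j → trans (sim-prod-inr-inl F₁ F₂ (X₂∈prod F₁ F₂ pF₁ pF₂) i j)
               (sym (sim-prod-inr-inl G₁ G₂ (X₂∈prod G₁ G₂ pG₁ pG₂) i j)))
    (λ i j → trans (sim-prod-inr F₁ F₂ (Pointed.⊥∈ pF₁) i j)
               (trans (same₂ i j) (sym (sim-prod-inr G₁ G₂ (Pointed.⊥∈ pG₁) i j))))

  module _ {F₁ G₁ : Family n₁} {F₂ G₂ : Family n₂}
           (pF₁ : Pointed F₁) (pF₂ : Pointed F₂) (pG₁ : Pointed G₁) (pG₂ : Pointed G₂) where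

    UpClosed-prod : ∀ Y₁ Y₂ →
      UpClosed (prod F₁ F₂) (prod G₁ G₂) (Y₁ ++ᵛ Y₂) ⇔ (UpClosed F₁ G₁ Y₁ × UpClosed F₂ G₂ Y₂)
    UpClosed-prod Y₁ Y₂ = mk⇔
      (λ up → (λ {i} {j} i→j Y₁i → subst T (lookup-++ˡ Y₁ Y₂ j) (up
                 (Sum.map (from (≤-prod-inl F₁ F₂ ⊥∈F₂ i j)) (from (≤-prod-inl G₁ G₂ ⊥∈G₂ j i)) i→j)
                 (subst T (sym (lookup-++ˡ Y₁ Y₂ i)) Y₁i)))
            , (λ {i} {j} i→j Y₂i → subst T (lookup-++ʳ Y₁ Y₂ j) (up
                 (Sum.map (from (≤-prod-inr F₁ F₂ ⊥∈F₁ i j)) (from (≤-prod-inr G₁ G₂ ⊥∈G₁ j i)) i→j)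
                 (subst T (sym (lookup-++ʳ Y₁ Y₂ i)) Y₂i))))
      (λ (up₁ , up₂) {x} {y} → elim-↑² Goal
        (λ i j i→j Yi → subst T (sym (lookup-++ˡ Y₁ Y₂ j)) (up₁
           (Sum.map (to (≤-prod-inl F₁ F₂ ⊥∈F₂ i j)) (to (≤-prod-inl G₁ G₂ ⊥∈G₂ j i)) i→j)
           (subst T (lookup-++ˡ Y₁ Y₂ i) Yi)))
        (λ i j i→j _ → ⊥-elim (Sum.[ ≰-prod-inl-inr F₁ F₂ (X₁∈prod F₁ F₂ pF₁ pF₂) i j
                                   , ≰-prod-inr-inl G₁ G₂ (X₂∈prod G₁ G₂ pG₁ pG₂) j i ] i→j))
        (λ i j i→j _ → ⊥-elim (Sum.[ ≰-prod-inr-inl F₁ F₂ (X₂∈prod F₁ F₂ pF₁ pF₂) i j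
                                   , ≰-prod-inl-inr G₁ G₂ (X₁∈prod G₁ G₂ pG₁ pG₂) j i ] i→j))
        (λ i j i→j Yi → subst T (sym (lookup-++ʳ Y₁ Y₂ j)) (up₂
           (Sum.map (to (≤-prod-inr F₁ F₂ ⊥∈F₁ i j)) (to (≤-prod-inr G₁ G₂ ⊥∈G₁ j i)) i→j)
           (subst T (lookup-++ʳ Y₁ Y₂ i) Yi)))
        x y)
      where
      ⊥∈F₁ = Pointed.⊥∈ pF₁
      ⊥∈F₂ = Pointed.⊥∈ pF₂
      ⊥∈G₁ = Pointed.⊥∈ pG₁
      ⊥∈G₂ = Pointed.⊥∈ pG₂
      Goal : Fin (n₁ + n₂) → Fin (n₁ + n₂) → Set
      Goal x y = x ≤[ prod F₁ F₂ ] y ⊎ y ≤[ prod G₁ G₂ ] x →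
                 T (lookup (Y₁ ++ᵛ Y₂) x) → T (lookup (Y₁ ++ᵛ Y₂) y)

    quotient-prod : quotient (prod F₁ F₂) (prod G₁ G₂) ≈ prod (quotient F₁ G₁) (quotient F₂ G₂)
    quotient-prod = (λ {Y} → elim-++ᵛ (λ Y → Y ∈ Q → Y ∈ P) Q⊆P Y)
                  , (λ {Y} → elim-++ᵛ (λ Y → Y ∈ P → Y ∈ Q) P⊆Q Y)
      where
      Q = quotient (prod F₁ F₂) (prod G₁ G₂)
      P = prod (quotient F₁ G₁) (quotient F₂ G₂)
      Q⊆P : ∀ Y₁ Y₂ → Y₁ ++ᵛ Y₂ ∈ Q → Y₁ ++ᵛ Y₂ ∈ P
      Q⊆P Y₁ Y₂ Y∈ = let up₁ , up₂ = to (UpClosed-prod Y₁ Y₂)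
                                          (to (∈-quotient {F = prod F₁ F₂} {prod G₁ G₂}) Y∈)
                     in from (∈-prod _ _ Y₁ Y₂) (from ∈-quotient up₁ , from ∈-quotient up₂)
      P⊆Q : ∀ Y₁ Y₂ → Y₁ ++ᵛ Y₂ ∈ P → Y₁ ++ᵛ Y₂ ∈ Q
      P⊆Q Y₁ Y₂ Y∈ = let Y₁∈ , Y₂∈ = to (∈-prod _ _ Y₁ Y₂) Y∈
                     in from ∈-quotient (from (UpClosed-prod Y₁ Y₂)
                          (to (∈-quotient {F = F₁} {G₁}) Y₁∈ , to (∈-quotient {F = F₂} {G₂}) Y₂∈))

    sim-quotient-inl : ∀ i j →
      sim (quotient (prod F₁ F₂) (prod G₁ G₂)) (i ↑ˡ n₂) (j ↑ˡ n₂) ≡ sim (quotient F₁ G₁) i j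
    sim-quotient-inl i j = trans (sim-resp-≈ quotient-prod _ _)
      (sim-prod-inl (quotient F₁ G₁) (quotient F₂ G₂) (Pointed.⊥∈ (quotient-pointed F₂ G₂)) i j)

    sim-quotient-inr : ∀ i j →
      sim (quotient (prod F₁ F₂) (prod G₁ G₂)) (n₁ ↑ʳ i) (n₁ ↑ʳ j) ≡ sim (quotient F₂ G₂) i j
    sim-quotient-inr i j = trans (sim-resp-≈ quotient-prod _ _)
      (sim-prod-inr (quotient F₁ G₁) (quotient F₂ G₂) (Pointed.⊥∈ (quotient-pointed F₁ G₁)) i j)

  restrict-prod-inl : (F₁ : Family n₁) (F₂ : Family n₂) → ⊥ ∈ F₂ → ∀ Y₁ →
    restrict (prod F₁ F₂) (Y₁ ++ᵛ ⊥) ≈ map (_++ᵛ ⊥) (restrict F₁ Y₁)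
  restrict-prod-inl F₁ F₂ ⊥∈F₂ Y₁ = restrict⊆ , ⊆restrict
    where
    ∩-Y₁⊥ : ∀ Z₁ Z₂ → (Z₁ ++ᵛ Z₂) ∩ (Y₁ ++ᵛ ⊥) ≡ (Z₁ ∩ Y₁) ++ᵛ ⊥
    ∩-Y₁⊥ Z₁ Z₂ = trans (∩-++ᵛ Z₁ Y₁ Z₂ ⊥) (cong ((Z₁ ∩ Y₁) ++ᵛ_) (∩-zeroʳ Z₂))
    image : ∀ Z → Z ∈ prod F₁ F₂ → Z ∩ (Y₁ ++ᵛ ⊥) ∈ map (_++ᵛ ⊥) (restrict F₁ Y₁)
    image = elim-++ᵛ _ λ Z₁ Z₂ Z∈ → subst (_∈ map (_++ᵛ ⊥) (restrict F₁ Y₁)) (sym (∩-Y₁⊥ Z₁ Z₂))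
      (∈-map⁺ (_++ᵛ ⊥) (∈-map⁺ (_∩ Y₁) (proj₁ (to (∈-prod F₁ F₂ Z₁ Z₂) Z∈))))
    restrict⊆ : restrict (prod F₁ F₂) (Y₁ ++ᵛ ⊥) ⊆ map (_++ᵛ ⊥) (restrict F₁ Y₁)
    restrict⊆ W∈ with ∈-map⁻ (_∩ (Y₁ ++ᵛ ⊥)) W∈
    ... | Z , Z∈ , refl = image Z Z∈
    ⊆restrict : map (_++ᵛ ⊥) (restrict F₁ Y₁) ⊆ restrict (prod F₁ F₂) (Y₁ ++ᵛ ⊥)
    ⊆restrict W∈ with ∈-map⁻ (_++ᵛ ⊥) W∈
    ... | U , U∈ , refl with ∈-map⁻ (_∩ Y₁) U∈
    ... | Z₁ , Z₁∈ , refl = subst (_∈ restrict (prod F₁ F₂) (Y₁ ++ᵛ ⊥)) (∩-Y₁⊥ Z₁ ⊥)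
      (∈-map⁺ (_∩ (Y₁ ++ᵛ ⊥)) (from (∈-prod F₁ F₂ Z₁ ⊥) (Z₁∈ , ⊥∈F₂)))

  restrict-prod-inr : (F₁ : Family n₁) (F₂ : Family n₂) → ⊥ ∈ F₁ → ∀ Y₂ →
    restrict (prod F₁ F₂) (⊥ ++ᵛ Y₂) ≈ map (⊥ ++ᵛ_) (restrict F₂ Y₂)
  restrict-prod-inr F₁ F₂ ⊥∈F₁ Y₂ = restrict⊆ , ⊆restrict
    where
    ∩-⊥Y₂ : ∀ Z₁ Z₂ → (Z₁ ++ᵛ Z₂) ∩ (⊥ ++ᵛ Y₂) ≡ ⊥ ++ᵛ (Z₂ ∩ Y₂)
    ∩-⊥Y₂ Z₁ Z₂ = trans (∩-++ᵛ Z₁ ⊥ Z₂ Y₂) (cong (_++ᵛ (Z₂ ∩ Y₂)) (∩-zeroʳ Z₁))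
    image : ∀ Z → Z ∈ prod F₁ F₂ → Z ∩ (⊥ ++ᵛ Y₂) ∈ map (⊥ ++ᵛ_) (restrict F₂ Y₂)
    image = elim-++ᵛ _ λ Z₁ Z₂ Z∈ → subst (_∈ map (⊥ ++ᵛ_) (restrict F₂ Y₂)) (sym (∩-⊥Y₂ Z₁ Z₂))
      (∈-map⁺ (⊥ ++ᵛ_) (∈-map⁺ (_∩ Y₂) (proj₂ (to (∈-prod F₁ F₂ Z₁ Z₂) Z∈))))
    restrict⊆ : restrict (prod F₁ F₂) (⊥ ++ᵛ Y₂) ⊆ map (⊥ ++ᵛ_) (restrict F₂ Y₂)
    restrict⊆ W∈ with ∈-map⁻ (_∩ (⊥ ++ᵛ Y₂)) W∈
    ... | Z , Z∈ , refl = image Z Z∈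
    ⊆restrict : map (⊥ ++ᵛ_) (restrict F₂ Y₂) ⊆ restrict (prod F₁ F₂) (⊥ ++ᵛ Y₂)
    ⊆restrict W∈ with ∈-map⁻ (⊥ ++ᵛ_) W∈
    ... | U , U∈ , refl with ∈-map⁻ (_∩ Y₂) U∈
    ... | Z₂ , Z₂∈ , refl = subst (_∈ restrict (prod F₁ F₂) (⊥ ++ᵛ Y₂)) (∩-⊥Y₂ ⊥ Z₂)
      (∈-map⁺ (_∩ (⊥ ++ᵛ Y₂)) (from (∈-prod F₁ F₂ ⊥ Z₂) (⊥∈F₁ , Z₂∈)))

  module _ (F₁ : Family n₁) (F₂ : Family n₂) where

    connected-inl : ⊥ ∈ F₂ → ∀ Y₁ →
      IsConnected (restrict (prod F₁ F₂) (Y₁ ++ᵛ ⊥)) (Y₁ ++ᵛ ⊥) ⇔ IsConnected (restrict F₁ Y₁) Y₁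
    connected-inl ⊥∈F₂ Y₁ = mk⇔ (to embedding ∘ transport) (transport⁻¹ ∘ from embedding)
      where
      transport : IsConnected (restrict (prod F₁ F₂) (Y₁ ++ᵛ ⊥)) (Y₁ ++ᵛ ⊥) →
                  IsConnected (map (_++ᵛ ⊥) (restrict F₁ Y₁)) (Y₁ ++ᵛ ⊥)
      transport = IsConnected-resp-≈ (restrict-prod-inl F₁ F₂ ⊥∈F₂ Y₁)
      transport⁻¹ : IsConnected (map (_++ᵛ ⊥) (restrict F₁ Y₁)) (Y₁ ++ᵛ ⊥) →
                    IsConnected (restrict (prod F₁ F₂) (Y₁ ++ᵛ ⊥)) (Y₁ ++ᵛ ⊥)
      transport⁻¹ = IsConnected-resp-≈ (≈-sym (restrict-prod-inl F₁ F₂ ⊥∈F₂ Y₁))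
      embedding = IsConnected-embedding (++-injectiveˡ _ _) (sym ⊥-++ᵛ)
        (λ U V → sym (trans (∩-++ᵛ U V ⊥ ⊥) (cong ((U ∩ V) ++ᵛ_) (∩-zeroʳ ⊥))))
        (λ U V → sym (trans (∪-++ᵛ U V ⊥ ⊥) (cong ((U ∪ V) ++ᵛ_) (∪-identityʳ ⊥)))) {restrict F₁ Y₁} {Y₁}

    connected-inr : ⊥ ∈ F₁ → ∀ Y₂ →
      IsConnected (restrict (prod F₁ F₂) (⊥ ++ᵛ Y₂)) (⊥ ++ᵛ Y₂) ⇔ IsConnected (restrict F₂ Y₂) Y₂
    connected-inr ⊥∈F₁ Y₂ = mk⇔ (to embedding ∘ transport) (transport⁻¹ ∘ from embedding)
      where
      transport : IsConnected (restrict (prod F₁ F₂) (⊥ ++ᵛ Y₂)) (⊥ ++ᵛ Y₂) →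
                  IsConnected (map (⊥ ++ᵛ_) (restrict F₂ Y₂)) (⊥ ++ᵛ Y₂)
      transport = IsConnected-resp-≈ (restrict-prod-inr F₁ F₂ ⊥∈F₁ Y₂)
      transport⁻¹ : IsConnected (map (⊥ ++ᵛ_) (restrict F₂ Y₂)) (⊥ ++ᵛ Y₂) →
                    IsConnected (restrict (prod F₁ F₂) (⊥ ++ᵛ Y₂)) (⊥ ++ᵛ Y₂)
      transport⁻¹ = IsConnected-resp-≈ (≈-sym (restrict-prod-inr F₁ F₂ ⊥∈F₁ Y₂))
      embedding = IsConnected-embedding (++-injectiveʳ ⊥ ⊥) (sym ⊥-++ᵛ)
        (λ U V → sym (trans (∩-++ᵛ ⊥ ⊥ U V) (cong (_++ᵛ (U ∩ V)) (∩-zeroʳ ⊥))))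
        (λ U V → sym (trans (∪-++ᵛ ⊥ ⊥ U V) (cong (_++ᵛ (U ∪ V)) (∪-identityʳ ⊥)))) {restrict F₂ Y₂} {Y₂}

    connected-prod : Pointed F₁ → Pointed F₂ → ∀ Y₁ Y₂ →
      IsConnected (restrict (prod F₁ F₂) (Y₁ ++ᵛ Y₂)) (Y₁ ++ᵛ Y₂) → Y₁ ≡ ⊥ ⊎ Y₂ ≡ ⊥
    connected-prod p₁ p₂ Y₁ Y₂ con =
      Sum.map (λ eq → ++-injectiveˡ Y₁ ⊥ (trans eq ⊥-++ᵛ)) (λ eq → ++-injectiveʳ ⊥ ⊥ (trans eq ⊥-++ᵛ))
        (con (part X₁ (X₁∈prod F₁ F₂ p₁ p₂) X₁∩Y) (part X₂ (X₂∈prod F₁ F₂ p₁ p₂) X₂∩Y) disjoint covering)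
      where
      Y = Y₁ ++ᵛ Y₂
      part : ∀ {U} Z → Z ∈ prod F₁ F₂ → Z ∩ Y ≡ U → U ∈ restrict (prod F₁ F₂) Y
      part Z Z∈ refl = ∈-map⁺ (_∩ Y) Z∈
      X₁∩Y : X₁ ∩ Y ≡ Y₁ ++ᵛ ⊥
      X₁∩Y = trans (∩-++ᵛ ⊤ Y₁ ⊥ Y₂) (cong₂ _++ᵛ_ (∩-identityˡ Y₁) (∩-zeroˡ Y₂))
      X₂∩Y : X₂ ∩ Y ≡ ⊥ ++ᵛ Y₂
      X₂∩Y = trans (∩-++ᵛ ⊥ Y₁ ⊤ Y₂) (cong₂ _++ᵛ_ (∩-zeroˡ Y₁) (∩-identityˡ Y₂))
      disjoint : (Y₁ ++ᵛ ⊥) ∩ (⊥ ++ᵛ Y₂) ≡ ⊥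
      disjoint = trans (∩-++ᵛ Y₁ ⊥ ⊥ Y₂) (trans (cong₂ _++ᵛ_ (∩-zeroʳ Y₁) (∩-zeroˡ Y₂)) (sym ⊥-++ᵛ))
      covering : (Y₁ ++ᵛ ⊥) ∪ (⊥ ++ᵛ Y₂) ≡ Y
      covering = trans (∪-++ᵛ Y₁ ⊥ ⊥ Y₂) (cong₂ _++ᵛ_ (∪-identityʳ Y₁) (∪-identityˡ Y₂))

  module _ {F₁ G₁ : Family n₁} {F₂ G₂ : Family n₂}
           (pF₁ : Pointed F₁) (pF₂ : Pointed F₂) (pG₁ : Pointed G₁) (pG₂ : Pointed G₂) where

    private
      ⊥∈F₁ = Pointed.⊥∈ pF₁
      ⊥∈F₂ = Pointed.⊥∈ pF₂
      ⊥∈G₁ = Pointed.⊥∈ pG₁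
      ⊥∈G₂ = Pointed.⊥∈ pG₂

    Admissible-prod⁻ : Admissible (prod F₁ F₂) (prod G₁ G₂) → Admissible F₁ G₁ × Admissible F₂ G₂
    Admissible-prod⁻ adm = adm₁ , adm₂
      where
      open Admissible adm
      adm₁ : Admissible F₁ G₁
      adm₁ = record
        { coarser = λ {U} U∈ → proj₁ (to (∈-prod G₁ G₂ U ⊥) (coarser (from (∈-prod F₁ F₂ U ⊥) (U∈ , ⊥∈F₂))))
        ; agrees-on-connected = λ Y₁ con → map-reflects-≈ (++-injectiveˡ _ _)
            (≈-trans (≈-sym (restrict-prod-inl G₁ G₂ ⊥∈G₂ Y₁))
              (≈-trans (agrees-on-connected (Y₁ ++ᵛ ⊥) (from (connected-inl G₁ G₂ ⊥∈G₂ Y₁) con))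
                (restrict-prod-inl F₁ F₂ ⊥∈F₂ Y₁)))
        ; same-classes = λ i j → trans (sym (sim-quotient-inl pF₁ pF₂ pG₁ pG₂ i j))
            (trans (same-classes _ _) (sim-quotient-inl pG₁ pG₂ pG₁ pG₂ i j)) }
      adm₂ : Admissible F₂ G₂
      adm₂ = record
        { coarser = λ {U} U∈ → proj₂ (to (∈-prod G₁ G₂ ⊥ U) (coarser (from (∈-prod F₁ F₂ ⊥ U) (⊥∈F₁ , U∈))))
        ; agrees-on-connected = λ Y₂ con → map-reflects-≈ (++-injectiveʳ ⊥ ⊥)
            (≈-trans (≈-sym (restrict-prod-inr G₁ G₂ ⊥∈G₁ Y₂))
              (≈-trans (agrees-on-connected (⊥ ++ᵛ Y₂) (from (connected-inr G₁ G₂ ⊥∈G₁ Y₂) con))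
                (restrict-prod-inr F₁ F₂ ⊥∈F₁ Y₂)))
        ; same-classes = λ i j → trans (sym (sim-quotient-inr pF₁ pF₂ pG₁ pG₂ i j))
            (trans (same-classes _ _) (sim-quotient-inr pG₁ pG₂ pG₁ pG₂ i j)) }

    Admissible-prod⁺ : Admissible F₁ G₁ → Admissible F₂ G₂ → Admissible (prod F₁ F₂) (prod G₁ G₂)
    Admissible-prod⁺ adm₁ adm₂ = record
      { coarser = prod-resp-⊆ (A₁.coarser) (A₂.coarser)
      ; agrees-on-connected = elim-++ᵛ _ agrees
      ; same-classes = λ x y → trans (sim-resp-≈ (quotient-prod pF₁ pF₂ pG₁ pG₂) x y)
          (trans (sim-prod-cong (quotient-pointed F₁ G₁) (quotient-pointed F₂ G₂)
                                (quotient-pointed G₁ G₁) (quotient-pointed G₂ G₂) A₁.same-classes A₂.same-classes x y)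
            (sym (sim-resp-≈ (quotient-prod pG₁ pG₂ pG₁ pG₂) x y))) }
      where
      module A₁ = Admissible adm₁
      module A₂ = Admissible adm₂
      agrees : ∀ Y₁ Y₂ → IsConnected (restrict (prod G₁ G₂) (Y₁ ++ᵛ Y₂)) (Y₁ ++ᵛ Y₂) →
        restrict (prod G₁ G₂) (Y₁ ++ᵛ Y₂) ≈ restrict (prod F₁ F₂) (Y₁ ++ᵛ Y₂)
      agrees Y₁ Y₂ con with connected-prod G₁ G₂ pG₁ pG₂ Y₁ Y₂ con
      ... | inj₂ refl = ≈-trans (restrict-prod-inl G₁ G₂ ⊥∈G₂ Y₁)
            (≈-trans (map-resp-≈ (_++ᵛ ⊥) (A₁.agrees-on-connected Y₁ (to (connected-inl G₁ G₂ ⊥∈G₂ Y₁) con)))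
              (≈-sym (restrict-prod-inl F₁ F₂ ⊥∈F₂ Y₁)))
      ... | inj₁ refl = ≈-trans (restrict-prod-inr G₁ G₂ ⊥∈G₁ Y₂)
            (≈-trans (map-resp-≈ (⊥ ++ᵛ_) (A₂.agrees-on-connected Y₂ (to (connected-inr G₁ G₂ ⊥∈G₁ Y₂) con)))
              (≈-sym (restrict-prod-inr F₁ F₂ ⊥∈F₁ Y₂)))

  OccursFactorwise : Family n₁ → Family n₂ → Family (n₁ + n₂) → Family (n₁ + n₂) → Set
  OccursFactorwise F₁ F₂ 𝒜 ℬ =
    ((IsProduct 𝒜 × IsProduct ℬ) × OccursInΓ F₁ (projˡ 𝒜) (projˡ ℬ)) × OccursInΓ F₂ (projʳ 𝒜) (projʳ ℬ)

  occursFactorwise : Family n₁ → Family n₂ → Family (n₁ + n₂) → Family (n₁ + n₂) → Bool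
  occursFactorwise F₁ F₂ 𝒜 ℬ =
    ((isProduct 𝒜 ∧ isProduct ℬ) ∧ occursInΓ F₁ (projˡ 𝒜) (projˡ ℬ)) ∧ occursInΓ F₂ (projʳ 𝒜) (projʳ ℬ)

  module _ {F₁ : Family n₁} {F₂ : Family n₂} (pF₁ : Pointed F₁) (pF₂ : Pointed F₂)
           {𝒜 ℬ : Family (n₁ + n₂)} where

    OccursInΓ-prod : OccursInΓ (prod F₁ F₂) 𝒜 ℬ ⇔ OccursFactorwise F₁ F₂ 𝒜 ℬ
    OccursInΓ-prod = mk⇔ factor combine
      where
      factor : OccursInΓ (prod F₁ F₂) 𝒜 ℬ → OccursFactorwise F₁ F₂ 𝒜 ℬ
      factor (top , adm , q≈ℬ) =
        let open Admissible adm
            𝒜-split = prod-proj top (coarser (X₁∈prod F₁ F₂ pF₁ pF₂)) (coarser (X₂∈prod F₁ F₂ pF₁ pF₂))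
            top₁ = IsTopology-projˡ top
            top₂ = IsTopology-projʳ top
            pA₁ = IsTopology.pointed top₁
            pA₂ = IsTopology.pointed top₂
            adm₁ , adm₂ = Admissible-prod⁻ pF₁ pF₂ pA₁ pA₂ (Admissible-resp-≈ (≈-sym 𝒜-split) adm)
            Q≈ℬ = ≈-trans (≈-sym (quotient-prod pF₁ pF₂ pA₁ pA₂))
                    (≈-trans (quotient-resp-≈ (≈-refl {F = prod F₁ F₂}) 𝒜-split) q≈ℬ)
            (Q₁≈B₁ , Q₂≈B₂) , ℬ-split = to (prod-≈-iff (Pointed.⊥∈ (quotient-pointed F₁ (projˡ 𝒜)))
                                                       (Pointed.⊥∈ (quotient-pointed F₂ (projʳ 𝒜)))) Q≈ℬ
        in ((𝒜-split , ℬ-split) , top₁ , adm₁ , Q₁≈B₁) , top₂ , adm₂ , Q₂≈B₂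
      combine : OccursFactorwise F₁ F₂ 𝒜 ℬ → OccursInΓ (prod F₁ F₂) 𝒜 ℬ
      combine (((𝒜-split , ℬ-split) , top₁ , adm₁ , Q₁≈B₁) , top₂ , adm₂ , Q₂≈B₂) =
        let pA₁ = IsTopology.pointed top₁
            pA₂ = IsTopology.pointed top₂
        in IsTopology-resp-≈ 𝒜-split (IsTopology-prod top₁ top₂)
         , Admissible-resp-≈ 𝒜-split (Admissible-prod⁺ pF₁ pF₂ pA₁ pA₂ adm₁ adm₂)
         , ≈-trans (quotient-resp-≈ (≈-refl {F = prod F₁ F₂}) (≈-sym 𝒜-split))
             (≈-trans (quotient-prod pF₁ pF₂ pA₁ pA₂) (≈-trans (prod-resp-≈ Q₁≈B₁ Q₂≈B₂) ℬ-split))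

    occursInΓ-prod : occursInΓ (prod F₁ F₂) 𝒜 ℬ ≡ occursFactorwise F₁ F₂ 𝒜 ℬ
    occursInΓ-prod = ≡-by-reflection (T-occursInΓ {F = prod F₁ F₂} {𝒜} {ℬ})
      (((T-famEq ∧-⇔ T-famEq) ∧-⇔ T-occursInΓ) ∧-⇔ T-occursInΓ)
      (to OccursInΓ-prod) (from OccursInΓ-prod)

  famEq-prod : {S₁ : Family n₁} {S₂ : Family n₂} → ⊥ ∈ S₁ → ⊥ ∈ S₂ → (𝒜 : Family (n₁ + n₂)) →
    famEq (prod S₁ S₂) 𝒜 ≡ (famEq S₁ (projˡ 𝒜) ∧ famEq S₂ (projʳ 𝒜)) ∧ isProduct 𝒜
  famEq-prod {S₁} {S₂} ⊥∈S₁ ⊥∈S₂ 𝒜 = ≡-by-reflection (T-famEq {F = prod S₁ S₂} {𝒜})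
    ((T-famEq ∧-⇔ T-famEq) ∧-⇔ T-famEq)
    (to (prod-≈-iff ⊥∈S₁ ⊥∈S₂)) (from (prod-≈-iff ⊥∈S₁ ⊥∈S₂))

  coeff-prodT : (L : Tensor2 n₁) (M : Tensor2 n₂) →
    (∀ {p} → p ∈ L → Pointed (proj₁ p) × Pointed (proj₂ p)) →
    (∀ {q} → q ∈ M → Pointed (proj₁ q) × Pointed (proj₂ q)) →
    (𝒜 ℬ : Family (n₁ + n₂)) →
    coeff 𝒜 ℬ (prodT L M)
      ≡ ind (isProduct 𝒜 ∧ isProduct ℬ) * coeff (projˡ 𝒜) (projˡ ℬ) L * coeff (projʳ 𝒜) (projʳ ℬ) M
  coeff-prodT L M L-pointed M-pointed 𝒜 ℬ = begin
    coeff 𝒜 ℬ (prodT L M)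
      ≡⟨ count-pairs _ _ (λ p → (isProduct 𝒜 ∧ isProduct ℬ) ∧ matches (projˡ 𝒜) (projˡ ℬ) p)
                         (matches (projʳ 𝒜) (projʳ ℬ)) L M factorise ⟩
    count (λ p → (isProduct 𝒜 ∧ isProduct ℬ) ∧ matches (projˡ 𝒜) (projˡ ℬ) p) L * coeff (projʳ 𝒜) (projʳ ℬ) M
      ≡⟨ cong (_* coeff (projʳ 𝒜) (projʳ ℬ) M) (count-∧ˡ (isProduct 𝒜 ∧ isProduct ℬ) _ L) ⟩
    ind (isProduct 𝒜 ∧ isProduct ℬ) * coeff (projˡ 𝒜) (projˡ ℬ) L * coeff (projʳ 𝒜) (projʳ ℬ) M ∎
    where
    open ≡-Reasoning
    matches : ∀ {m} → Family m → Family m → Family m × Family m → Bool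
    matches A B p = famEq (proj₁ p) A ∧ famEq (proj₂ p) B
    factorise : ∀ {p q} → p ∈ L → q ∈ M →
      matches 𝒜 ℬ (prod (proj₁ p) (proj₁ q) , prod (proj₂ p) (proj₂ q))
        ≡ ((isProduct 𝒜 ∧ isProduct ℬ) ∧ matches (projˡ 𝒜) (projˡ ℬ) p) ∧ matches (projʳ 𝒜) (projʳ ℬ) q
    factorise {S₁ , Q₁} {S₂ , Q₂} p∈ q∈ =
      let pS₁ , pQ₁ = L-pointed p∈ ; pS₂ , pQ₂ = M-pointed q∈
      in trans (cong₂ _∧_ (famEq-prod (Pointed.⊥∈ pS₁) (Pointed.⊥∈ pS₂) 𝒜)
                          (famEq-prod (Pointed.⊥∈ pQ₁) (Pointed.⊥∈ pQ₂) ℬ))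
           (regroup (famEq S₁ (projˡ 𝒜)) (famEq S₂ (projʳ 𝒜)) (isProduct 𝒜)
                    (famEq Q₁ (projˡ ℬ)) (famEq Q₂ (projʳ ℬ)) (isProduct ℬ))
      where
      regroup : ∀ a₁ a₂ a b₁ b₂ b → ((a₁ ∧ a₂) ∧ a) ∧ ((b₁ ∧ b₂) ∧ b) ≡ ((a ∧ b) ∧ (a₁ ∧ b₁)) ∧ (a₂ ∧ b₂)
      regroup = solve 6 (λ a₁ a₂ a b₁ b₂ b →
        ((a₁ ⊕ a₂) ⊕ a) ⊕ ((b₁ ⊕ b₂) ⊕ b) ⊜ ((a ⊕ b) ⊕ (a₁ ⊕ b₁)) ⊕ (a₂ ⊕ b₂)) refl

proposition3p3 : (n₁ n₂ : ℕ) (T₁ : Family n₁) (T₂ : Family n₂) →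
    T (isTopology T₁) → T (isTopology T₂) →
    (A B : Family (n₁ + n₂)) → T (isTopology A) → T (isTopology B) →
    coeff A B (Γ (prod T₁ T₂)) ≡ coeff A B (prodT (Γ T₁) (Γ T₂))
proposition3p3 n₁ n₂ T₁ T₂ top₁ top₂ A B _ _ = begin
  coeff A B (Γ (prod T₁ T₂))
    ≡⟨ coeff-Γ (prod T₁ T₂) A B ⟩
  ind (occursInΓ (prod T₁ T₂) A B)
    ≡⟨ cong ind (occursInΓ-prod (pointed {F = T₁} top₁) (pointed {F = T₂} top₂) {A} {B}) ⟩
  ind (occursFactorwise T₁ T₂ A B)
    ≡⟨ ind-∧∧ (isProduct A ∧ isProduct B) (occursInΓ T₁ A₁ B₁) (occursInΓ T₂ A₂ B₂) ⟩
  ind (isProduct A ∧ isProduct B) * ind (occursInΓ T₁ A₁ B₁) * ind (occursInΓ T₂ A₂ B₂)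
    ≡⟨ cong₂ (λ c₁ c₂ → ind (isProduct A ∧ isProduct B) * c₁ * c₂) (coeff-Γ T₁ A₁ B₁) (coeff-Γ T₂ A₂ B₂) ⟨
  ind (isProduct A ∧ isProduct B) * coeff A₁ B₁ (Γ T₁) * coeff A₂ B₂ (Γ T₂)
    ≡⟨ coeff-prodT (Γ T₁) (Γ T₂) (Γ-pointed T₁) (Γ-pointed T₂) A B ⟨
  coeff A B (prodT (Γ T₁) (Γ T₂)) ∎
  where
  open ≡-Reasoning
  open Product n₁ n₂
  A₁ = projˡ A
  A₂ = projʳ A
  B₁ = projˡ B
  B₂ = projʳ B
  pointed : ∀ {m} {F : Family m} → T (isTopology F) → Pointed F
  pointed = IsTopology.pointed ∘ to T-isTopology
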